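{- Let $\alpha,\beta$ be parameters, $n\ge1$, $x_1,\dots,x_n$ variables and $\lambda$ a partition. Then $g^{(\alpha,\beta)}_\lambda(x_1,\dots,x_n)$ equals the partition function of the following lattice model: $n$ rows with bosonic horizontal labels (nonnegative integers), row $k$ (from the bottom) having parameter $x_k$, bottom boundary all $0$, top boundary $(m^c_j(\lambda))_{j\ge1}$, right boundary value $0$, free left boundary, and vertex weights $$w_x(a,b;c,d)=\delta_{a+b,c+d}\begin{cases}\beta(\alpha+\beta)^{a-d-1}(x+\alpha)^{d}& a>0,\ a>d,\\ x(x+\alpha)^{a-1}& 0<a\le d,\\ 1& a=0.\end{cases}$$
   Context: Dual canonical Grothendieck polynomials. For $\mu\subseteq\lambda$ let $r(\lambda/\mu)$, $c(\lambda/\mu)$, $b(\lambda/\mu)$ be the numbers of nonempty rows, nonempty columns and edge-connected components of $\lambda/\mu$. The $g^{(\alpha,\beta)}_\lambda$ are determined by $g^{(\alpha,\beta)}_\lambda()=\delta_{\lambda,\emptyset}$ (no variables) and $g^{(\alpha,\beta)}_\lambda(x_1,\dots,x_{n+1})=\sum_{\mu\subseteq\lambda}g^{(\alpha,\beta)}_\mu(x_1,\dots,x_n)g^{(\alpha,\beta)}_{\lambda/\mu}(x_{n+1})$, $g^{(\alpha,\beta)}_{\lambda/\mu}(x)=\beta^{r-b}(\alpha+\beta)^{|\lambda|-|\mu|-r-c+b}x^{b}(\alpha+x)^{c-b}$ with $r,c,b$ evaluated on $\lambda/\mu$. Lattice conventions. A vertex has left label $a$, bottom label $b$, right label $c$,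 top label $d$. A row with parameter $x$ is a sequence of vertices at sites $j=1,2,\dots$, the right label at site $j$ being the left label at site $j+1$; vertical labels are nonnegative integers; the left label at site 1 is free (summed over all values) and the right labels must be eventually equal to the prescribed right boundary value. Rows $1,\dots,n$ are stacked bottom to top, top labels of row $k$ = bottom labels of row $k+1$; bottom labels of row 1 and top labels of row $n$ are prescribed. The partition function is the sum over all labelings of non-prescribed edges of the product of vertex weights. $m^c_j(\lambda)=\lambda_j-\lambda_{j+1}$. -}

module Defs where

open import Level using (Level)
open import Data.Bool using (Bool; true; false; if_then_else_; _∧_; _∨_; not)
open import Data.Nat using (ℕ; zero; suc; _+_; _∸_; _≤_; _<_; _≤ᵇ_; _<ᵇ_; _≡ᵇ_)
open import Data.Nat.ListAction using (sum)
open import Data.List using (List; []; _∷_; map; concatMap; upTo; length; foldr; concat; reverse; replicate; applyUpTo)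
open import Data.List.Relation.Unary.All using (All)
open import Data.List.Relation.Unary.Linked using (Linked)
open import Data.Vec as Vec using (Vec; toList)
open import Algebra.Bundles using (CommutativeRing)

IsPartition : List ℕ → Set
IsPartition λ′ = Linked (λ a b → b ≤ a) λ′ × All (λ a → 0 < a) λ′
  where open import Data.Product using (_×_)

-- 1-indexed part λ_i (0 beyond the length)
part : List ℕ → ℕ → ℕ
part []       _             = 0
part (_ ∷ _)  zero          = 0
part (a ∷ _)  (suc zero)    = a
part (_ ∷ as) (suc (suc i)) = part as (suc i)

size : List ℕ → ℕ
size = sum

mc : List ℕ → ℕ → ℕ
mc λ′ j = part λ′ j ∸ part λ′ (suc j)

filt : {A : Set} → (A → Bool) → List A → List A
filt p []       = []
filt p (x ∷ xs) = if p x then x ∷ filt p xs else filt p xs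

anyᵇ : {A : Set} → (A → Bool) → List A → Bool
anyᵇ p = foldr (λ x r → p x ∨ r) false

decreasingᵇ : List ℕ → Bool
decreasingᵇ []           = true
decreasingᵇ (_ ∷ [])     = true
decreasingᵇ (a ∷ b ∷ as) = (b ≤ᵇ a) ∧ decreasingᵇ (b ∷ as)

boxChoices : List ℕ → List (List ℕ)
boxChoices []       = [] ∷ []
boxChoices (l ∷ ls) = concatMap (λ v → map (v ∷_) (boxChoices ls)) (upTo (suc l))

-- all partitions μ ⊆ λ (each exactly once, as lists of positive parts)
subPartitions : List ℕ → List (List ℕ)
subPartitions λ′ =
  map (filt (λ a → 0 <ᵇ a)) (filt decreasingᵇ (boxChoices λ′))

-- Skew shapes λ/μ: cells (i , j), 1-indexed, with μ_i < j ≤ λ_i.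

record Cell : Set where
  constructor cell
  field
    row : ℕ
    col : ℕ

skewCells : List ℕ → List ℕ → List Cell
skewCells λ′ μ =
  concatMap (λ i → map (λ j → cell (suc i) (suc j))
                       (filt (λ j → part μ (suc i) <ᵇ suc j) (upTo (part λ′ (suc i)))))
            (upTo (length λ′))

rowsOf : List ℕ → List ℕ → ℕ
rowsOf λ′ μ = length (filt (λ i → anyᵇ (λ x → Cell.row x ≡ᵇ i) (skewCells λ′ μ))
                           (applyUpTo suc (length λ′)))

colsOf : List ℕ → List ℕ → ℕ
colsOf λ′ μ = length (filt (λ j → anyᵇ (λ x → Cell.col x ≡ᵇ j) (skewCells λ′ μ))
                           (applyUpTo suc (part λ′ 1)))

distℕ : ℕ → ℕ → ℕ
distℕ a b = (a ∸ b) + (b ∸ a)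

adjacentᵇ : Cell → Cell → Bool
adjacentᵇ (cell i j) (cell i′ j′) = (distℕ i i′ + distℕ j j′) ≡ᵇ 1

insertCell : Cell → List (List Cell) → List (List Cell)
insertCell x comps =
  (x ∷ concat (filt (anyᵇ (adjacentᵇ x)) comps))
    ∷ filt (λ k → not (anyᵇ (adjacentᵇ x) k)) comps

components : List Cell → List (List Cell)
components = foldr insertCell []

compsOf : List ℕ → List ℕ → ℕ
compsOf λ′ μ = length (components (skewCells λ′ μ))

module _ {c ℓ : Level} (R : CommutativeRing c ℓ) where
  open CommutativeRing R using (Carrier; 0#; 1#) renaming (_+_ to _⊕_; _*_ to _⊛_)

  pow : Carrier → ℕ → Carrier
  pow x zero    = 1#
  pow x (suc n) = x ⊛ pow x n

  Σ : {A : Set} → List A → (A → Carrier) → Carrier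
  Σ xs f = foldr (λ a r → f a ⊕ r) 0# xs

  δ : Bool → Carrier
  δ true  = 1#
  δ false = 0#

  gSkew : Carrier → Carrier → List ℕ → List ℕ → Carrier → Carrier
  gSkew α β λ′ μ x =
    pow β (r ∸ b) ⊛ pow (α ⊕ β) ((size λ′ ∸ size μ + b) ∸ (r + c′))
      ⊛ pow x b ⊛ pow (α ⊕ x) (c′ ∸ b)
    where
      r  = rowsOf λ′ μ
      c′ = colsOf λ′ μ
      b  = compsOf λ′ μ

  -- gRev λ (x_m ∷ ... ∷ x_1) = g_λ(x_1,...,x_m)   (last variable first)
  gRev : Carrier → Carrier → List ℕ → List Carrier → Carrier
  gRev α β λ′ []       = δ (length λ′ ≡ᵇ 0)
  gRev α β λ′ (x ∷ xs) = Σ (subPartitions λ′) (λ μ → gRev α β μ xs ⊛ gSkew α β λ′ μ x)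

  gDual : Carrier → Carrier → List ℕ → {n : ℕ} → Vec Carrier n → Carrier
  gDual α β λ′ xs = gRev α β λ′ (reverse (toList xs))

  weight : Carrier → Carrier → Carrier → ℕ → ℕ → ℕ → ℕ → Carrier
  weight α β x a b c′ d =
    if (a + b) ≡ᵇ (c′ + d)
    then (if a ≡ᵇ 0 then 1#
          else if d <ᵇ a then β ⊛ pow (α ⊕ β) (a ∸ d ∸ 1) ⊛ pow (x ⊕ α) d
          else x ⊛ pow (x ⊕ α) (a ∸ 1))
    else 0#

  -- Truncated row: sites 1..W (W = length of the label lists), all
  -- horizontal labels in 0..M; `a` is the left label of the first
  -- remaining site; the right label after the last site is 0.
  rowFrom : Carrier → Carrier → ℕ → Carrier → ℕ → List ℕ → List ℕ → Carrier
  rowFrom α β M x a []       []       = δ (a ≡ᵇ 0)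
  rowFrom α β M x a (b ∷ bs) (d ∷ ds) =
    Σ (upTo (suc M)) (λ c′ → weight α β x a b c′ d ⊛ rowFrom α β M x c′ bs ds)
  rowFrom α β M x a _        _        = 0#

  rowZ : Carrier → Carrier → ℕ → Carrier → List ℕ → List ℕ → Carrier
  rowZ α β M x bs ds = Σ (upTo (suc M)) (λ a → rowFrom α β M x a bs ds)

  labelVecs : ℕ → ℕ → List (List ℕ)
  labelVecs W M = boxChoices (replicate W M)

  -- partition function of rows x_1 (bottom), ..., x_n (top) on sites 1..W,
  -- all labels in 0..M, bottom labels `bot`, top labels `top`
  latticeZ : Carrier → Carrier → ℕ → ℕ → {n : ℕ} → Vec Carrier (suc n) → List ℕ → List ℕ → Carrier
  latticeZ α β W M (x Vec.∷ Vec.[])       bot top = rowZ α β M x bot top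
  latticeZ α β W M (x Vec.∷ y Vec.∷ xs) bot top =
    Σ (labelVecs W M) (λ mid → rowZ α β M x bot mid ⊛ latticeZ α β W M (y Vec.∷ xs) mid top)

  modelZ : Carrier → Carrier → List ℕ → ℕ → ℕ → {n : ℕ} → Vec Carrier (suc n) → Carrier
  modelZ α β λ′ W M xs =
    latticeZ α β W M xs (replicate W 0) (map (mc λ′) (applyUpTo suc W))

module Submission where

-- Both sides are built row by row. The definition of g_λ peels off one variable at a time via
-- g_λ(x_1,…,x_{n+1}) = Σ_μ g_μ(x_1,…,x_n) g_{λ/μ}(x_{n+1}); the partition function peels off the
-- top row. So it suffices that one row, with top labels m^c(λ) and bottom labels v, has weight
-- g_{λ/μ}(x) when v = m^c(μ) for some μ ⊆ λ, and 0 otherwise. Conservation a + b = c + d forces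
-- the horizontal labels to be λ_j − μ_j, where μ_j = v_j + v_{j+1} + …, so only μ ⊆ λ survive.
-- The surviving product of vertex weights is a monomial in β, α + β, x, α + x whose exponents are
-- sums of per-row contributions; these sums count the rows, columns and connected components of
-- λ/μ, each component being counted at its lowest row.

open import Defs
open import Data.Nat using (ℕ; suc; _≤_)
open import Data.List using (List; length)
open import Data.Nat.ListAction using (sum)
open import Data.Vec using (Vec)
open import Algebra.Bundles using (CommutativeRing)

module NatBool where

  open import Data.Bool using (Bool; true; false; _∧_; _∨_; T)
  open import Data.Nat using (zero; suc; _+_; _∸_; _≤_; _<_; _≤ᵇ_; _<ᵇ_; _≡ᵇ_)
  open import Data.Nat.Properties
  open import Data.Product using (_×_; _,_)
  open import Data.Sum using (_⊎_; inj₁; inj₂)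
  open import Relation.Binary.PropositionalEquality

  T→≡ : ∀ {b} → T b → b ≡ true
  T→≡ {true} _ = refl

  ≡→T : ∀ {b} → b ≡ true → T b
  ≡→T refl = _

  bool-iff : (b c : Bool) → (b ≡ true → c ≡ true) → (c ≡ true → b ≡ true) → b ≡ c
  bool-iff false false f g = refl
  bool-iff false true f g = g refl
  bool-iff true false f g = sym (f refl)
  bool-iff true true f g = refl

  ≡ᵇ→≡ : ∀ m n → (m ≡ᵇ n) ≡ true → m ≡ n
  ≡ᵇ→≡ m n e = ≡ᵇ⇒≡ m n (≡→T e)

  ≡→≡ᵇ : ∀ m n → m ≡ n → (m ≡ᵇ n) ≡ true
  ≡→≡ᵇ m n e = T→≡ (≡⇒≡ᵇ m n e)

  ≤ᵇ→≤ : ∀ m n → (m ≤ᵇ n) ≡ true → m ≤ n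
  ≤ᵇ→≤ m n e = ≤ᵇ⇒≤ m n (≡→T e)

  ≤→≤ᵇ : ∀ m n → m ≤ n → (m ≤ᵇ n) ≡ true
  ≤→≤ᵇ m n e = T→≡ (≤⇒≤ᵇ e)

  <ᵇ→< : ∀ m n → (m <ᵇ n) ≡ true → m < n
  <ᵇ→< m n e = <ᵇ⇒< m n (≡→T e)

  <→<ᵇ : ∀ m n → m < n → (m <ᵇ n) ≡ true
  <→<ᵇ m n e = T→≡ (<⇒<ᵇ e)

  ∧-true⁻ : ∀ {a b} → (a ∧ b) ≡ true → (a ≡ true) × (b ≡ true)
  ∧-true⁻ {true} {true} _ = refl , refl

  ∧-true⁺ : ∀ {a b} → a ≡ true → b ≡ true → (a ∧ b) ≡ true
  ∧-true⁺ refl refl = refl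

  ∨-true⁻ : ∀ {a b} → (a ∨ b) ≡ true → (a ≡ true) ⊎ (b ≡ true)
  ∨-true⁻ {true} e = inj₁ refl
  ∨-true⁻ {false} e = inj₂ e

  ∨-true⁺ʳ : ∀ a {b} → b ≡ true → (a ∨ b) ≡ true
  ∨-true⁺ʳ true e = refl
  ∨-true⁺ʳ false e = e

  ≡ᵇ-sym : ∀ m n → (m ≡ᵇ n) ≡ (n ≡ᵇ m)
  ≡ᵇ-sym zero zero = refl
  ≡ᵇ-sym zero (suc n) = refl
  ≡ᵇ-sym (suc m) zero = refl
  ≡ᵇ-sym (suc m) (suc n) = ≡ᵇ-sym m n

  <ᵇ-irrefl : ∀ n → (n <ᵇ n) ≡ false
  <ᵇ-irrefl zero = refl
  <ᵇ-irrefl (suc n) = <ᵇ-irrefl n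

  >0⇒≡ᵇ0-false : ∀ {n} → 0 < n → (n ≡ᵇ 0) ≡ false
  >0⇒≡ᵇ0-false {suc n} _ = refl

  ∸-telescope : ∀ h hl l → h ≤ hl → hl ≤ l → (hl ∸ h) + (l ∸ hl) ≡ l ∸ h
  ∸-telescope h hl l p q with m≤n⇒∃[o]m+o≡n p | m≤n⇒∃[o]m+o≡n q
  ... | s , refl | t , refl = begin
    (h + s ∸ h) + (h + s + t ∸ (h + s)) ≡⟨ cong₂ _+_ (m+n∸m≡n h s) (m+n∸m≡n (h + s) t) ⟩
    s + t                               ≡⟨ sym (m+n∸m≡n h (s + t)) ⟩
    h + (s + t) ∸ h                     ≡⟨ cong (_∸ h) (sym (+-assoc h s t)) ⟩
    h + s + t ∸ h                       ∎
    where open ≡-Reasoning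

  ≡ᵇ-∸-split : ∀ a v h l → h ≤ l → (a + v ≡ᵇ l ∸ h) ≡ ((v + h ≤ᵇ l) ∧ (a ≡ᵇ l ∸ (v + h)))
  ≡ᵇ-∸-split a v h l h≤l with m≤n⇒∃[o]m+o≡n h≤l
  ... | m , refl = bool-iff _ _ fw bw
    where
    rearrange : ∀ b → h + (b + v) ≡ b + (v + h)
    rearrange b = trans (+-comm h (b + v)) (+-assoc b v h)

    fw : (a + v ≡ᵇ h + m ∸ h) ≡ true → ((v + h ≤ᵇ h + m) ∧ (a ≡ᵇ h + m ∸ (v + h))) ≡ true
    fw e = ∧-true⁺ (≤→≤ᵇ _ _ (subst (v + h ≤_) hm (m≤n+m (v + h) a)))
                   (≡→≡ᵇ _ _ (sym (trans (cong (_∸ (v + h)) (sym hm)) (m+n∸n≡m a (v + h)))))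
      where
      hm : a + (v + h) ≡ h + m
      hm = trans (sym (rearrange a)) (cong (h +_) (trans (≡ᵇ→≡ _ _ e) (m+n∸m≡n h m)))

    bw : ((v + h ≤ᵇ h + m) ∧ (a ≡ᵇ h + m ∸ (v + h))) ≡ true → (a + v ≡ᵇ h + m ∸ h) ≡ true
    bw e with ∧-true⁻ e
    ... | le , ea with m≤n⇒∃[o]m+o≡n (≤ᵇ→≤ _ _ le)
    ...   | k , eq = ≡→≡ᵇ _ _ (trans (+-cancelˡ-≡ h _ _ (trans (rearrange a) (trans (cong (_+ (v + h)) a≡k) (trans (+-comm k (v + h)) eq)))) (sym (m+n∸m≡n h m)))
      where
      a≡k : a ≡ k
      a≡k = trans (≡ᵇ→≡ _ _ ea) (trans (cong (_∸ (v + h)) (sym eq)) (m+n∸m≡n (v + h) k))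


module NatSums where

  open import Data.Nat using (ℕ; zero; suc; _+_; _∸_; _≤_; _<_; z≤n; s≤s)
  open import Data.Nat.Properties
  open import Relation.Binary.PropositionalEquality
  open ≡-Reasoning

  sumBelow : (ℕ → ℕ) → ℕ → ℕ
  sumBelow g zero = 0
  sumBelow g (suc k) = g 0 + sumBelow (λ t → g (suc t)) k

  sumBelow-+ : ∀ (g h : ℕ → ℕ) k → sumBelow (λ t → g t + h t) k ≡ sumBelow g k + sumBelow h k
  sumBelow-+ g h zero = refl
  sumBelow-+ g h (suc k) = trans (cong (g 0 + h 0 +_) (sumBelow-+ (λ t → g (suc t)) (λ t → h (suc t)) k)) (+-interchange (g 0) (h 0) _ _)
    where open import Algebra.Properties.CommutativeSemigroup +-commutativeSemigroup using () renaming (interchange to +-interchange)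

  sumBelow-cong< : ∀ (g h : ℕ → ℕ) k → (∀ t → t < k → g t ≡ h t) → sumBelow g k ≡ sumBelow h k
  sumBelow-cong< g h zero e = refl
  sumBelow-cong< g h (suc k) e = cong₂ _+_ (e 0 (s≤s z≤n)) (sumBelow-cong< (λ t → g (suc t)) (λ t → h (suc t)) k (λ t lt → e (suc t) (s≤s lt)))

  sumBelow-cong : ∀ (g h : ℕ → ℕ) k → (∀ t → g t ≡ h t) → sumBelow g k ≡ sumBelow h k
  sumBelow-cong g h k e = sumBelow-cong< g h k (λ t _ → e t)

  sumBelow-zero : ∀ (g : ℕ → ℕ) k → (∀ t → g t ≡ 0) → sumBelow g k ≡ 0
  sumBelow-zero g zero e = refl
  sumBelow-zero g (suc k) e = trans (cong (_+ sumBelow (λ t → g (suc t)) k) (e 0)) (sumBelow-zero (λ t → g (suc t)) k (λ t → e (suc t)))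

  sumBelow-split : ∀ (g : ℕ → ℕ) a b → sumBelow g (a + b) ≡ sumBelow g a + sumBelow (λ t → g (a + t)) b
  sumBelow-split g zero b = refl
  sumBelow-split g (suc a) b = trans (cong (g 0 +_) (sumBelow-split (λ t → g (suc t)) a b)) (sym (+-assoc (g 0) _ _))

  sumBelow-extend : ∀ (g : ℕ → ℕ) ℓ W → ℓ ≤ W → (∀ t → ℓ ≤ t → g t ≡ 0) → sumBelow g ℓ ≡ sumBelow g W
  sumBelow-extend g ℓ W le z = begin
    sumBelow g ℓ                                       ≡⟨ sym (+-identityʳ _) ⟩
    sumBelow g ℓ + 0                                   ≡⟨ cong (sumBelow g ℓ +_) (sym (sumBelow-zero (λ t → g (ℓ + t)) (W ∸ ℓ) (λ t → z (ℓ + t) (m≤m+n ℓ t)))) ⟩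
    sumBelow g ℓ + sumBelow (λ t → g (ℓ + t)) (W ∸ ℓ)  ≡⟨ sym (sumBelow-split g ℓ (W ∸ ℓ)) ⟩
    sumBelow g (ℓ + (W ∸ ℓ))                           ≡⟨ cong (sumBelow g) (m+[n∸m]≡n le) ⟩
    sumBelow g W                                       ∎

  sumBelow-snoc : ∀ (g : ℕ → ℕ) k → sumBelow g (suc k) ≡ sumBelow g k + g k
  sumBelow-snoc g k = begin
    sumBelow g (suc k)                              ≡⟨ cong (sumBelow g) (+-comm 1 k) ⟩
    sumBelow g (k + 1)                              ≡⟨ sumBelow-split g k 1 ⟩
    sumBelow g k + (g (k + 0) + 0)                  ≡⟨ cong (λ z → sumBelow g k + z) (trans (+-identityʳ _) (cong g (+-identityʳ k))) ⟩
    sumBelow g k + g k                              ∎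

  sumBelow-∸ : ∀ (g h : ℕ → ℕ) k → (∀ t → h t ≤ g t) → sumBelow g k ∸ sumBelow h k ≡ sumBelow (λ t → g t ∸ h t) k
  sumBelow-∸ g h k le = begin
    sumBelow g k ∸ sumBelow h k                        ≡⟨ cong (_∸ sumBelow h k) (sumBelow-cong g (λ t → (g t ∸ h t) + h t) k (λ t → sym (m∸n+n≡m (le t)))) ⟩
    sumBelow (λ t → (g t ∸ h t) + h t) k ∸ sumBelow h k ≡⟨ cong (_∸ sumBelow h k) (sumBelow-+ (λ t → g t ∸ h t) h k) ⟩
    (sumBelow (λ t → g t ∸ h t) k + sumBelow h k) ∸ sumBelow h k ≡⟨ m+n∸n≡m (sumBelow (λ t → g t ∸ h t) k) (sumBelow h k) ⟩
    sumBelow (λ t → g t ∸ h t) k                       ∎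


module FiniteSums where

  open import Defs
  open NatBool using (≡ᵇ-sym)
  open import Level using (Level)
  open import Data.Bool using (Bool; true; false; _∧_)
  open import Data.Nat using (ℕ; zero; suc; _≤_; _<_; _≡ᵇ_; s≤s)
  open import Data.List using (List; []; _∷_; map; concatMap; upTo; _++_; applyUpTo; replicate)
  open import Data.List.Membership.Propositional using (_∈_)
  open import Data.List.Relation.Unary.Any using (here; there)
  open import Data.List.Relation.Binary.Pointwise using (Pointwise; []; _∷_)
  open import Relation.Binary.PropositionalEquality as P using (_≡_)
  open import Algebra.Bundles using (CommutativeRing)

  eqᵇ : List ℕ → List ℕ → Bool
  eqᵇ [] [] = true
  eqᵇ (a ∷ as) (b ∷ bs) = (a ≡ᵇ b) ∧ eqᵇ as bs
  eqᵇ _ _ = false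

  eqᵇ-sym : ∀ as bs → eqᵇ as bs ≡ eqᵇ bs as
  eqᵇ-sym [] [] = P.refl
  eqᵇ-sym [] (_ ∷ _) = P.refl
  eqᵇ-sym (_ ∷ _) [] = P.refl
  eqᵇ-sym (a ∷ as) (b ∷ bs) = P.cong₂ _∧_ (≡ᵇ-sym a b) (eqᵇ-sym as bs)

  module Sums {c ℓ : Level} (R : CommutativeRing c ℓ) where
    open CommutativeRing R renaming (_+_ to _⊕_; _*_ to _⊛_)
    open import Relation.Binary.Reasoning.Setoid setoid

    ∑ : {A : Set} → List A → (A → Carrier) → Carrier
    ∑ = Σ R

    𝟙 : Bool → Carrier
    𝟙 = δ R

    ∑-cong : {A : Set} (xs : List A) {f g : A → Carrier} → (∀ a → f a ≈ g a) → ∑ xs f ≈ ∑ xs g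
    ∑-cong [] h = refl
    ∑-cong (x ∷ xs) h = +-cong (h x) (∑-cong xs h)

    ∑-cong-∈ : {A : Set} (xs : List A) {f g : A → Carrier} → (∀ a → a ∈ xs → f a ≈ g a) → ∑ xs f ≈ ∑ xs g
    ∑-cong-∈ [] h = refl
    ∑-cong-∈ (x ∷ xs) h = +-cong (h x (here P.refl)) (∑-cong-∈ xs (λ a m → h a (there m)))

    ∑-++ : {A : Set} (xs ys : List A) (f : A → Carrier) → ∑ (xs ++ ys) f ≈ ∑ xs f ⊕ ∑ ys f
    ∑-++ [] ys f = sym (+-identityˡ _)
    ∑-++ (x ∷ xs) ys f = begin
      f x ⊕ ∑ (xs ++ ys) f ≈⟨ +-cong refl (∑-++ xs ys f) ⟩
      f x ⊕ (∑ xs f ⊕ ∑ ys f) ≈⟨ sym (+-assoc _ _ _) ⟩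
      (f x ⊕ ∑ xs f) ⊕ ∑ ys f ∎

    ∑-map : {A B : Set} (g : A → B) (xs : List A) (f : B → Carrier) → ∑ (map g xs) f ≡ ∑ xs (λ a → f (g a))
    ∑-map g [] f = P.refl
    ∑-map g (x ∷ xs) f = P.cong (f (g x) ⊕_) (∑-map g xs f)

    ∑-concatMap : {A B : Set} (h : A → List B) (xs : List A) (f : B → Carrier) →
      ∑ (concatMap h xs) f ≈ ∑ xs (λ a → ∑ (h a) f)
    ∑-concatMap h [] f = refl
    ∑-concatMap h (x ∷ xs) f = begin
      ∑ (h x ++ concatMap h xs) f ≈⟨ ∑-++ (h x) _ f ⟩
      ∑ (h x) f ⊕ ∑ (concatMap h xs) f ≈⟨ +-cong refl (∑-concatMap h xs f) ⟩
      ∑ (h x) f ⊕ ∑ xs (λ a → ∑ (h a) f) ∎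

    ∑-*ˡ : {A : Set} (k : Carrier) (xs : List A) (f : A → Carrier) → k ⊛ ∑ xs f ≈ ∑ xs (λ a → k ⊛ f a)
    ∑-*ˡ k [] f = zeroʳ k
    ∑-*ˡ k (x ∷ xs) f = trans (distribˡ k _ _) (+-cong refl (∑-*ˡ k xs f))

    ∑-*ʳ : {A : Set} (k : Carrier) (xs : List A) (f : A → Carrier) → ∑ xs f ⊛ k ≈ ∑ xs (λ a → f a ⊛ k)
    ∑-*ʳ k [] f = zeroˡ k
    ∑-*ʳ k (x ∷ xs) f = trans (distribʳ k _ _) (+-cong refl (∑-*ʳ k xs f))

    ∑-+ : {A : Set} (xs : List A) (f g : A → Carrier) → ∑ xs (λ a → f a ⊕ g a) ≈ ∑ xs f ⊕ ∑ xs g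
    ∑-+ [] f g = sym (+-identityˡ _)
    ∑-+ (x ∷ xs) f g = trans (+-cong refl (∑-+ xs f g)) (+-interchange _ _ _ _)
      where open import Algebra.Properties.CommutativeSemigroup +-commutativeSemigroup using () renaming (interchange to +-interchange)

    ∑-zero : {A : Set} (xs : List A) {f : A → Carrier} → (∀ a → f a ≈ 0#) → ∑ xs f ≈ 0#
    ∑-zero [] h = refl
    ∑-zero (x ∷ xs) h = trans (+-cong (h x) (∑-zero xs h)) (+-identityˡ _)

    ∑-swap : {A B : Set} (xs : List A) (ys : List B) (f : A → B → Carrier) →
      ∑ xs (λ a → ∑ ys (λ b → f a b)) ≈ ∑ ys (λ b → ∑ xs (λ a → f a b))
    ∑-swap [] ys f = sym (∑-zero ys (λ _ → refl))
    ∑-swap (x ∷ xs) ys f = begin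
      ∑ ys (f x) ⊕ ∑ xs (λ a → ∑ ys (f a)) ≈⟨ +-cong refl (∑-swap xs ys f) ⟩
      ∑ ys (f x) ⊕ ∑ ys (λ b → ∑ xs (λ a → f a b)) ≈⟨ sym (∑-+ ys _ _) ⟩
      ∑ ys (λ b → f x b ⊕ ∑ xs (λ a → f a b)) ∎

    𝟙-∧ : (a b : Bool) → 𝟙 (a ∧ b) ≈ 𝟙 a ⊛ 𝟙 b
    𝟙-∧ false b = sym (zeroˡ _)
    𝟙-∧ true b = sym (*-identityˡ _)

    ∑-applyUpTo-∘ : (f g : ℕ → ℕ) (n : ℕ) (h : ℕ → Carrier) → ∑ (applyUpTo (λ i → g (f i)) n) h ≡ ∑ (applyUpTo f n) (λ v → h (g v))
    ∑-applyUpTo-∘ f g zero h = P.refl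
    ∑-applyUpTo-∘ f g (suc n) h = P.cong (h (g (f 0)) ⊕_) (∑-applyUpTo-∘ (λ i → f (suc i)) g n h)

    ∑-upTo-suc : (n : ℕ) (h : ℕ → Carrier) → ∑ (upTo (suc n)) h ≡ h 0 ⊕ ∑ (upTo n) (λ v → h (suc v))
    ∑-upTo-suc n h = P.cong (h 0 ⊕_) (∑-applyUpTo-∘ (λ i → i) suc n h)

    ∑-𝟙-≡ᵇ : (n b : ℕ) (g : ℕ → Carrier) → b < n →
          ∑ (upTo n) (λ v → 𝟙 (b ≡ᵇ v) ⊛ g v) ≈ g b
    ∑-𝟙-≡ᵇ (suc n) zero g _ = begin
      ∑ (upTo (suc n)) (λ v → 𝟙 (0 ≡ᵇ v) ⊛ g v) ≡⟨ ∑-upTo-suc n _ ⟩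
      𝟙 true ⊛ g 0 ⊕ ∑ (upTo n) (λ v → 𝟙 (0 ≡ᵇ suc v) ⊛ g (suc v)) ≈⟨ +-cong (*-identityˡ _) (∑-zero (upTo n) λ _ → zeroˡ _) ⟩
      g 0 ⊕ 0# ≈⟨ +-identityʳ _ ⟩
      g 0 ∎
    ∑-𝟙-≡ᵇ (suc n) (suc b) g (s≤s lt) = begin
      ∑ (upTo (suc n)) (λ v → 𝟙 (suc b ≡ᵇ v) ⊛ g v) ≡⟨ ∑-upTo-suc n _ ⟩
      𝟙 false ⊛ g 0 ⊕ ∑ (upTo n) (λ v → 𝟙 (b ≡ᵇ v) ⊛ g (suc v)) ≈⟨ +-cong (zeroˡ _) (∑-𝟙-≡ᵇ n b (λ v → g (suc v)) lt) ⟩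
      0# ⊕ g (suc b) ≈⟨ +-identityˡ _ ⟩
      g (suc b) ∎

    ∑-boxChoices-∷ : (l : ℕ) (ls : List ℕ) (f : List ℕ → Carrier) →
      ∑ (boxChoices (l ∷ ls)) f ≈ ∑ (upTo (suc l)) (λ v → ∑ (boxChoices ls) (λ vs → f (v ∷ vs)))
    ∑-boxChoices-∷ l ls f = trans (∑-concatMap (λ v → map (v ∷_) (boxChoices ls)) (upTo (suc l)) f) (∑-cong (upTo (suc l)) (λ v → reflexive (∑-map (v ∷_) (boxChoices ls) f)))

    ∑-filt : {A : Set} (p : A → Bool) (xs : List A) (f : A → Carrier) → ∑ (filt p xs) f ≈ ∑ xs (λ a → 𝟙 (p a) ⊛ f a)
    ∑-filt p [] f = refl
    ∑-filt p (x ∷ xs) f with p x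
    ... | true = +-cong (sym (*-identityˡ _)) (∑-filt p xs f)
    ... | false = trans (∑-filt p xs f) (trans (sym (+-identityˡ _)) (+-cong (sym (zeroˡ _)) refl))

    ∑-boxChoices-zeros : ∀ k (g : List ℕ → Carrier) → ∑ (boxChoices (replicate k 0)) g ≈ g (replicate k 0)
    ∑-boxChoices-zeros zero g = +-identityʳ _
    ∑-boxChoices-zeros (suc k) g = begin
      ∑ (boxChoices (0 ∷ replicate k 0)) g                  ≈⟨ ∑-boxChoices-∷ 0 (replicate k 0) g ⟩
      ∑ (boxChoices (replicate k 0)) (λ vs → g (0 ∷ vs)) ⊕ 0# ≈⟨ +-identityʳ _ ⟩
      ∑ (boxChoices (replicate k 0)) (λ vs → g (0 ∷ vs))      ≈⟨ ∑-boxChoices-zeros k (λ vs → g (0 ∷ vs)) ⟩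
      g (replicate (suc k) 0)                                ∎

    ∑-boxChoices-padded : ∀ ls k (g : List ℕ → Carrier) →
      ∑ (boxChoices (ls ++ replicate k 0)) g ≈ ∑ (boxChoices ls) (λ u → g (u ++ replicate k 0))
    ∑-boxChoices-padded [] k g = trans (∑-boxChoices-zeros k g) (sym (+-identityʳ _))
    ∑-boxChoices-padded (l ∷ ls) k g = begin
      ∑ (boxChoices (l ∷ (ls ++ replicate k 0))) g
        ≈⟨ ∑-boxChoices-∷ l (ls ++ replicate k 0) g ⟩
      ∑ (upTo (suc l)) (λ v → ∑ (boxChoices (ls ++ replicate k 0)) (λ vs → g (v ∷ vs)))
        ≈⟨ ∑-cong (upTo (suc l)) (λ v → ∑-boxChoices-padded ls k (λ vs → g (v ∷ vs))) ⟩
      ∑ (upTo (suc l)) (λ v → ∑ (boxChoices ls) (λ u → g (v ∷ (u ++ replicate k 0))))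
        ≈⟨ sym (∑-boxChoices-∷ l ls (λ u → g (u ++ replicate k 0))) ⟩
      ∑ (boxChoices (l ∷ ls)) (λ u → g (u ++ replicate k 0)) ∎

    ∑-𝟙-eqᵇ : ∀ ls b → Pointwise _≤_ b ls → (g : List ℕ → Carrier) → ∑ (boxChoices ls) (λ m → 𝟙 (eqᵇ b m) ⊛ g m) ≈ g b
    ∑-𝟙-eqᵇ [] [] [] g = trans (+-identityʳ _) (*-identityˡ _)
    ∑-𝟙-eqᵇ (l ∷ ls) (b₁ ∷ b′) (b₁≤l ∷ b′≤ls) g = begin
      ∑ (boxChoices (l ∷ ls)) (λ m → 𝟙 (eqᵇ (b₁ ∷ b′) m) ⊛ g m)
        ≈⟨ ∑-boxChoices-∷ l ls _ ⟩
      ∑ (upTo (suc l)) (λ v → ∑ (boxChoices ls) (λ vs → 𝟙 ((b₁ ≡ᵇ v) ∧ eqᵇ b′ vs) ⊛ g (v ∷ vs)))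
        ≈⟨ ∑-cong (upTo (suc l)) (λ v → ∑-cong (boxChoices ls) (λ vs → trans (*-cong (𝟙-∧ (b₁ ≡ᵇ v) (eqᵇ b′ vs)) refl) (*-assoc _ _ _))) ⟩
      ∑ (upTo (suc l)) (λ v → ∑ (boxChoices ls) (λ vs → 𝟙 (b₁ ≡ᵇ v) ⊛ (𝟙 (eqᵇ b′ vs) ⊛ g (v ∷ vs))))
        ≈⟨ ∑-cong (upTo (suc l)) (λ v → sym (∑-*ˡ (𝟙 (b₁ ≡ᵇ v)) (boxChoices ls) _)) ⟩
      ∑ (upTo (suc l)) (λ v → 𝟙 (b₁ ≡ᵇ v) ⊛ ∑ (boxChoices ls) (λ vs → 𝟙 (eqᵇ b′ vs) ⊛ g (v ∷ vs)))
        ≈⟨ ∑-cong (upTo (suc l)) (λ v → *-cong refl (∑-𝟙-eqᵇ ls b′ b′≤ls (λ vs → g (v ∷ vs)))) ⟩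
      ∑ (upTo (suc l)) (λ v → 𝟙 (b₁ ≡ᵇ v) ⊛ g (v ∷ b′))
        ≈⟨ ∑-𝟙-≡ᵇ (suc l) b₁ (λ v → g (v ∷ b′)) (s≤s b₁≤l) ⟩
      g (b₁ ∷ b′) ∎


module PartitionLists where

  open import Defs
  open NatBool
  open import Data.Bool using (Bool; true; false; _∧_)
  open import Data.Nat using (ℕ; zero; suc; _+_; _≤_; _<_; _≤ᵇ_; _<ᵇ_; z≤n; s≤s; s≤s⁻¹)
  open import Data.Nat.Properties
  open import Data.Nat.ListAction using (sum)
  import Data.List.Properties
  open import Data.List using (List; []; _∷_; map; upTo; length; _++_; applyUpTo; replicate)
  open import Data.List.Relation.Unary.All as All using (All; []; _∷_)
  open import Data.List.Relation.Unary.Any using (here; there)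
  open import Data.List.Relation.Unary.Linked as Linked using (Linked; []; [-]; _∷_)
  open import Data.List.Relation.Binary.Pointwise using (Pointwise; []; _∷_; Pointwise-length)
  open import Data.List.Membership.Propositional using (_∈_; find)
  open import Data.List.Membership.Propositional.Properties using (∈-map⁻; ∈-concatMap⁻; ∈-upTo⁻)
  open import Data.Product using (_×_; _,_; proj₁; proj₂; ∃)
  open import Relation.Binary.PropositionalEquality

  head₀ : List ℕ → ℕ
  head₀ [] = 0
  head₀ (x ∷ _) = x

  dropZeros : List ℕ → List ℕ
  dropZeros = filt (λ a → 0 <ᵇ a)

  Decreasing : List ℕ → Set
  Decreasing = Linked (λ a b → b ≤ a)

  Decreasing-head₀ : ∀ {l L} → Decreasing (l ∷ L) → head₀ L ≤ l
  Decreasing-head₀ [-] = z≤n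
  Decreasing-head₀ (l≥ ∷ _) = l≥

  decreasing-parts : ∀ (p f : ℕ → ℕ) k → (∀ t → p (f (suc t)) ≤ p (f t)) → Decreasing (map p (applyUpTo f k))
  decreasing-parts p f zero h = []
  decreasing-parts p f (suc zero) h = [-]
  decreasing-parts p f (suc (suc k)) h = h 0 ∷ decreasing-parts p (λ t → f (suc t)) (suc k) (λ t → h (suc t))

  ∈-filt⁻ : ∀ {A : Set} {p : A → Bool} {x : A} (xs : List A) → x ∈ filt p xs → (x ∈ xs) × (p x ≡ true)
  ∈-filt⁻ {p = p} (y ∷ ys) m with p y in eq
  ∈-filt⁻ {p = p} (y ∷ ys) (here refl) | true = here refl , eq
  ∈-filt⁻ {p = p} (y ∷ ys) (there m) | true = there (proj₁ (∈-filt⁻ ys m)) , proj₂ (∈-filt⁻ ys m)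
  ∈-filt⁻ {p = p} (y ∷ ys) m | false = there (proj₁ (∈-filt⁻ ys m)) , proj₂ (∈-filt⁻ ys m)

  anyᵇ⁺ : ∀ {A : Set} (P : A → Bool) {x} xs → x ∈ xs → P x ≡ true → anyᵇ P xs ≡ true
  anyᵇ⁺ P (y ∷ ys) (here refl) e rewrite e = refl
  anyᵇ⁺ P (y ∷ ys) (there m) e with P y
  ... | true = refl
  ... | false = anyᵇ⁺ P ys m e

  anyᵇ⁻ : ∀ {A : Set} (P : A → Bool) xs → anyᵇ P xs ≡ true → ∃ λ x → (x ∈ xs) × (P x ≡ true)
  anyᵇ⁻ P (y ∷ ys) e with P y in ey
  ... | true = y , here refl , ey
  ... | false with anyᵇ⁻ P ys e
  ...   | z , m , pz = z , there m , pz

  ∈-filt⁺ : ∀ {A : Set} (p : A → Bool) {x} xs → x ∈ xs → p x ≡ true → x ∈ filt p xs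
  ∈-filt⁺ p (y ∷ ys) (here refl) e rewrite e = here refl
  ∈-filt⁺ p (y ∷ ys) (there m) e with p y
  ... | true = there (∈-filt⁺ p ys m e)
  ... | false = ∈-filt⁺ p ys m e

  boxChoices-pointwise : ∀ ls {u} → u ∈ boxChoices ls → Pointwise _≤_ u ls
  boxChoices-pointwise [] (here refl) = []
  boxChoices-pointwise (l ∷ ls) m with find (∈-concatMap⁻ (λ v → map (v ∷_) (boxChoices ls)) {xs = upTo (suc l)} m)
  ... | v , vm , m′ with ∈-map⁻ (v ∷_) m′
  ... | us , usm , refl = s≤s⁻¹ (∈-upTo⁻ vm) ∷ boxChoices-pointwise ls usm

  pointwise-sum≤ : ∀ {u ls} → Pointwise _≤_ u ls → sum u ≤ sum ls
  pointwise-sum≤ [] = z≤n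
  pointwise-sum≤ (a ∷ p) = +-mono-≤ a (pointwise-sum≤ p)

  pointwise-part≤ : ∀ {u ls} → Pointwise _≤_ u ls → ∀ j → part u j ≤ part ls j
  pointwise-part≤ [] j = z≤n
  pointwise-part≤ (a ∷ p) zero = z≤n
  pointwise-part≤ (a ∷ p) (suc zero) = a
  pointwise-part≤ (a ∷ []) (suc (suc j)) = z≤n
  pointwise-part≤ (a ∷ (b ∷ p)) (suc (suc j)) = pointwise-part≤ (b ∷ p) (suc j)

  decreasingᵇ⇒Decreasing : ∀ u → decreasingᵇ u ≡ true → Decreasing u
  decreasingᵇ⇒Decreasing [] e = []
  decreasingᵇ⇒Decreasing (a ∷ []) e = [-]
  decreasingᵇ⇒Decreasing (a ∷ b ∷ u) e = ≤ᵇ→≤ b a (proj₁ (∧-true⁻ e)) ∷ decreasingᵇ⇒Decreasing (b ∷ u) (proj₂ (∧-true⁻ {b ≤ᵇ a} e))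

  Zeros : List ℕ → Set
  Zeros = All (λ a → a ≡ 0)

  zeros-after-0 : ∀ u → Decreasing (0 ∷ u) → Zeros u
  zeros-after-0 [] _ = []
  zeros-after-0 (b ∷ u) (z≤n ∷ d) = refl ∷ zeros-after-0 u d

  dropZeros-zeros : ∀ u → Zeros u → dropZeros u ≡ []
  dropZeros-zeros [] _ = refl
  dropZeros-zeros (.0 ∷ u) (refl ∷ z) = dropZeros-zeros u z

  dropZeros-decreasing : ∀ u → Decreasing u → Decreasing (dropZeros u)
  dropZeros-decreasing [] d = []
  dropZeros-decreasing (zero ∷ u) d = subst Decreasing (sym (dropZeros-zeros u (zeros-after-0 u d))) []
  dropZeros-decreasing (suc a ∷ []) d = [-]
  dropZeros-decreasing (suc a ∷ zero ∷ u) (_ ∷ d) rewrite dropZeros-zeros u (zeros-after-0 u d) = [-]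
  dropZeros-decreasing (suc a ∷ suc b ∷ u) (p ∷ d) = p ∷ dropZeros-decreasing (suc b ∷ u) d

  dropZeros-positive : ∀ u → All (λ a → 0 < a) (dropZeros u)
  dropZeros-positive [] = []
  dropZeros-positive (zero ∷ u) = dropZeros-positive u
  dropZeros-positive (suc a ∷ u) = s≤s z≤n ∷ dropZeros-positive u

  dropZeros-length : ∀ u → length (dropZeros u) ≤ length u
  dropZeros-length [] = z≤n
  dropZeros-length (zero ∷ u) = m≤n⇒m≤1+n (dropZeros-length u)
  dropZeros-length (suc a ∷ u) = s≤s (dropZeros-length u)

  dropZeros-sum : ∀ u → sum (dropZeros u) ≡ sum u
  dropZeros-sum [] = refl
  dropZeros-sum (zero ∷ u) = dropZeros-sum u
  dropZeros-sum (suc a ∷ u) = cong (suc a +_) (dropZeros-sum u)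

  part-zeros : ∀ u → Zeros u → ∀ j → part u j ≡ 0
  part-zeros [] _ j = refl
  part-zeros (_ ∷ u) _ zero = refl
  part-zeros (.0 ∷ u) (refl ∷ _) (suc zero) = refl
  part-zeros (.0 ∷ []) (refl ∷ z) (suc (suc j)) = refl
  part-zeros (.0 ∷ (b ∷ u)) (refl ∷ z) (suc (suc j)) = part-zeros (b ∷ u) z (suc j)

  part-cons : ∀ a u j → part (a ∷ u) (suc (suc j)) ≡ part u (suc j)
  part-cons a [] j = refl
  part-cons a (b ∷ u) j = refl

  dropZeros-part : ∀ u → Decreasing u → ∀ j → part (dropZeros u) j ≡ part u j
  dropZeros-part [] d j = refl
  dropZeros-part (zero ∷ u) d j rewrite dropZeros-zeros u (zeros-after-0 u d) = sym (part-zeros (0 ∷ u) (refl ∷ zeros-after-0 u d) j)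
  dropZeros-part (suc a ∷ u) d zero = refl
  dropZeros-part (suc a ∷ u) d (suc zero) = refl
  dropZeros-part (suc a ∷ u) d (suc (suc j)) = trans (part-cons (suc a) (dropZeros u) j) (trans (dropZeros-part u (Linked.tail d) (suc j)) (sym (part-cons (suc a) u j)))

  part-beyond : ∀ xs t → length xs ≤ t → part xs (suc t) ≡ 0
  part-beyond [] t _ = refl
  part-beyond (x ∷ []) (suc t) _ = refl
  part-beyond (x ∷ y ∷ xs) (suc t) (s≤s le) = part-beyond (y ∷ xs) t le

  part-dec : ∀ xs → Decreasing xs → ∀ t → part xs (suc (suc t)) ≤ part xs (suc t)
  part-dec [] d t = z≤n
  part-dec (x ∷ []) d t = z≤n
  part-dec (x ∷ y ∷ xs) (p ∷ d) zero = p
  part-dec (x ∷ y ∷ xs) (p ∷ d) (suc t) = part-dec (y ∷ xs) d t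

  part≤sum : ∀ xs j → part xs j ≤ sum xs
  part≤sum [] j = z≤n
  part≤sum (x ∷ xs) zero = z≤n
  part≤sum (x ∷ xs) (suc zero) = m≤m+n x (sum xs)
  part≤sum (x ∷ []) (suc (suc j)) = z≤n
  part≤sum (x ∷ y ∷ xs) (suc (suc j)) = ≤-trans (part≤sum (y ∷ xs) (suc j)) (m≤n+m _ x)

  mapAp-ext : ∀ (f : ℕ → ℕ) (g h : ℕ → ℕ) n → (∀ t → g (f t) ≡ h (f t)) → map g (applyUpTo f n) ≡ map h (applyUpTo f n)
  mapAp-ext f g h zero e = refl
  mapAp-ext f g h (suc n) e = cong₂ _∷_ (e 0) (mapAp-ext (λ t → f (suc t)) g h n (λ t → e (suc t)))

  map-const0 : ∀ (f : ℕ → ℕ) k → map (λ _ → 0) (applyUpTo f k) ≡ replicate k 0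
  map-const0 f zero = refl
  map-const0 f (suc k) = cong (0 ∷_) (map-const0 (λ t → f (suc t)) k)

  parts-padded : ∀ xs k → map (part xs) (applyUpTo suc (length xs + k)) ≡ xs ++ replicate k 0
  parts-padded [] k = trans (mapAp-ext suc (part []) (λ _ → 0) k (λ t → refl)) (map-const0 suc k)
  parts-padded (x ∷ xs) k = cong (x ∷_) (begin
      map (part (x ∷ xs)) (applyUpTo (λ t → suc (suc t)) (length xs + k)) ≡⟨ Data.List.Properties.map-applyUpTo (λ t → suc (suc t)) (part (x ∷ xs)) (length xs + k) ⟩
      applyUpTo (λ t → part (x ∷ xs) (suc (suc t))) (length xs + k) ≡⟨ ap-ext (length xs + k) (λ t → part-cons x xs t) ⟩
      applyUpTo (λ t → part xs (suc t)) (length xs + k) ≡⟨ sym (Data.List.Properties.map-applyUpTo suc (part xs) (length xs + k)) ⟩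
      map (part xs) (applyUpTo suc (length xs + k)) ≡⟨ parts-padded xs k ⟩
      xs ++ replicate k 0 ∎)
    where
    open ≡-Reasoning
    ap-ext : ∀ {g h : ℕ → ℕ} n → (∀ t → g t ≡ h t) → applyUpTo g n ≡ applyUpTo h n
    ap-ext zero e = refl
    ap-ext (suc n) e = cong₂ _∷_ (e 0) (ap-ext n (λ t → e (suc t)))

  decreasingᵇ-zeros : ∀ k → decreasingᵇ (replicate k 0) ≡ true
  decreasingᵇ-zeros zero = refl
  decreasingᵇ-zeros (suc zero) = refl
  decreasingᵇ-zeros (suc (suc k)) = decreasingᵇ-zeros (suc k)

  decreasingᵇ-padded : ∀ u k → decreasingᵇ (u ++ replicate k 0) ≡ decreasingᵇ u
  decreasingᵇ-padded [] k = decreasingᵇ-zeros k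
  decreasingᵇ-padded (a ∷ []) zero = refl
  decreasingᵇ-padded (a ∷ []) (suc k) = decreasingᵇ-zeros (suc k)
  decreasingᵇ-padded (a ∷ b ∷ u) k = cong ((b ≤ᵇ a) ∧_) (decreasingᵇ-padded (b ∷ u) k)

  parts-bounded : ∀ (p f : ℕ → ℕ) k M → (∀ t → p t ≤ M) → All (_≤ M) (map p (applyUpTo f k))
  parts-bounded p f zero M h = []
  parts-bounded p f (suc k) M h = h (f 0) ∷ parts-bounded p (λ t → f (suc t)) k M h

  parts : ℕ → List ℕ → List ℕ
  parts W λ′ = map (part λ′) (applyUpTo suc W)

  length-parts : ∀ W λ′ → length (parts W λ′) ≡ W
  length-parts W λ′ = trans (Data.List.Properties.length-map (part λ′) (applyUpTo suc W)) (Data.List.Properties.length-applyUpTo suc W)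

  padded-dropZeros : ∀ u k → Decreasing u → u ++ replicate k 0 ≡ parts (length u + k) (dropZeros u)
  padded-dropZeros u k du =
    trans (sym (parts-padded u k)) (mapAp-ext suc (part u) (part (dropZeros u)) (length u + k) (λ t → sym (dropZeros-part u du (suc t))))

  subPartitions-facts : ∀ λ′ μ → μ ∈ subPartitions λ′ → IsPartition μ × length μ ≤ length λ′ × sum μ ≤ sum λ′
  subPartitions-facts λ′ μ m with ∈-map⁻ dropZeros m
  ... | u , um , refl with ∈-filt⁻ (boxChoices λ′) um
  ... | ub , ed = (dropZeros-decreasing u (decreasingᵇ⇒Decreasing u ed) , dropZeros-positive u)
                , subst (length (dropZeros u) ≤_) (Pointwise-length pu) (dropZeros-length u)
                , subst (_≤ sum λ′) (sym (dropZeros-sum u)) (pointwise-sum≤ pu)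
    where pu = boxChoices-pointwise λ′ ub

  zeros-pointwise≤ : ∀ W M → Pointwise _≤_ (replicate W 0) (replicate W M)
  zeros-pointwise≤ zero M = []
  zeros-pointwise≤ (suc W) M = z≤n ∷ zeros-pointwise≤ W M

  map-pointwise≤ : ∀ (g f : ℕ → ℕ) W M → (∀ t → g t ≤ M) → Pointwise _≤_ (map g (applyUpTo f W)) (replicate W M)
  map-pointwise≤ g f zero M h = []
  map-pointwise≤ g f (suc W) M h = h (f 0) ∷ map-pointwise≤ g (λ t → f (suc t)) W M h


module SuffixSums where

  open import Defs
  open FiniteSums
  open NatBool
  open PartitionLists using (head₀)
  open import Level using (Level)
  open import Data.Bool using (Bool; true; false; _∧_)
  open import Data.Nat using (ℕ; zero; suc; _+_; _∸_; _≤_; _≤ᵇ_; z≤n; s≤s)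
  open import Data.Nat.Properties using (+-suc; m≤n⇒m≤1+n; m+n∸n≡m)
  import Data.Nat.Properties as ℕ
  open import Data.List using (List; []; _∷_; map; upTo; length; applyUpTo; replicate)
  open import Data.List.Relation.Unary.All using (All; []; _∷_)
  open import Data.Product using (proj₁)
  open import Relation.Binary.PropositionalEquality as P using (_≡_)
  open import Algebra.Bundles using (CommutativeRing)

  ≤ᵇ-suc : (v l : ℕ) → (suc v ≤ᵇ suc l) ≡ (v ≤ᵇ l)
  ≤ᵇ-suc zero l = P.refl
  ≤ᵇ-suc (suc v) l = P.refl

  suffixSums : List ℕ → List ℕ
  suffixSums [] = []
  suffixSums (v ∷ vs) = (v + head₀ (suffixSums vs)) ∷ suffixSums vs

  pointwise≤ᵇ : List ℕ → List ℕ → Bool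
  pointwise≤ᵇ [] [] = true
  pointwise≤ᵇ (x ∷ xs) (y ∷ ys) = (x ≤ᵇ y) ∧ pointwise≤ᵇ xs ys
  pointwise≤ᵇ _ _ = false

  decreasingᵇ-∷ : (u1 : ℕ) (u : List ℕ) → decreasingᵇ (u1 ∷ u) ≡ ((head₀ u ≤ᵇ u1) ∧ decreasingᵇ u)
  decreasingᵇ-∷ u1 [] = P.refl
  decreasingᵇ-∷ u1 (x ∷ u) = P.refl

  differences : List ℕ → List ℕ
  differences [] = []
  differences (l ∷ L) = (l ∸ head₀ L) ∷ differences L

  pointwise≤ᵇ-head : ∀ U L → pointwise≤ᵇ U L ≡ true → head₀ U ≤ head₀ L
  pointwise≤ᵇ-head [] [] e = z≤n
  pointwise≤ᵇ-head (u ∷ U) (l ∷ L) e = ≤ᵇ→≤ u l (proj₁ (∧-true⁻ e))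
  pointwise≤ᵇ-head [] (_ ∷ _) ()
  pointwise≤ᵇ-head (_ ∷ _) [] ()

  head₀-≤ : ∀ {M} L → All (_≤ M) L → head₀ L ≤ M
  head₀-≤ [] [] = z≤n
  head₀-≤ (l ∷ L) (p ∷ _) = p

  differences-parts : ∀ (p f : ℕ → ℕ) k → (∀ t → f (suc t) ≡ suc (f t)) → p (f k) ≡ 0 →
    differences (map p (applyUpTo f k)) ≡ map (λ j → p j ∸ p (suc j)) (applyUpTo f k)
  differences-parts p f zero e z = P.refl
  differences-parts p f (suc zero) e z = P.cong (λ t → (p (f 0) ∸ t) ∷ []) (P.sym (P.trans (P.cong p (P.sym (e 0))) z))
  differences-parts p f (suc (suc k)) e z = P.cong₂ _∷_ (P.cong (λ t → p (f 0) ∸ p t) (e 0)) (differences-parts p (λ t → f (suc t)) (suc k) (λ t → e (suc t)) z)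

  differences-suffixSums : ∀ v → differences (suffixSums v) ≡ v
  differences-suffixSums [] = P.refl
  differences-suffixSums (v ∷ vs) = P.cong₂ _∷_ (m+n∸n≡m v (head₀ (suffixSums vs))) (differences-suffixSums vs)


  module Reindexing {c ℓ : Level} (R : CommutativeRing c ℓ) where
    open CommutativeRing R hiding (zero) renaming (_+_ to _⊕_; _*_ to _⊛_)
    open Sums R
    open import Relation.Binary.Reasoning.Setoid setoid
    open import Algebra.Properties.CommutativeSemigroup *-commutativeSemigroup using (xy∙z≈y∙xz)

    ∑-upTo-𝟙≤ᵇ : (n l : ℕ) (f : ℕ → Carrier) → suc l ≤ n →
      ∑ (upTo n) (λ v → 𝟙 (v ≤ᵇ l) ⊛ f v) ≈ ∑ (upTo (suc l)) (λ u → 𝟙 true ⊛ f u)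
    ∑-upTo-𝟙≤ᵇ (suc n) zero f _ = begin
      ∑ (upTo (suc n)) (λ v → 𝟙 (v ≤ᵇ 0) ⊛ f v) ≡⟨ ∑-upTo-suc n _ ⟩
      𝟙 true ⊛ f 0 ⊕ ∑ (upTo n) (λ v → 𝟙 false ⊛ f (suc v)) ≈⟨ +-cong refl (∑-zero (upTo n) (λ _ → zeroˡ _)) ⟩
      𝟙 true ⊛ f 0 ⊕ 0# ∎
    ∑-upTo-𝟙≤ᵇ (suc n) (suc l) f (s≤s le) = begin
      ∑ (upTo (suc n)) (λ v → 𝟙 (v ≤ᵇ suc l) ⊛ f v) ≡⟨ ∑-upTo-suc n _ ⟩
      𝟙 true ⊛ f 0 ⊕ ∑ (upTo n) (λ v → 𝟙 (suc v ≤ᵇ suc l) ⊛ f (suc v))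
        ≈⟨ +-cong refl (∑-cong (upTo n) (λ v → *-cong (reflexive (P.cong 𝟙 (≤ᵇ-suc v l))) refl)) ⟩
      𝟙 true ⊛ f 0 ⊕ ∑ (upTo n) (λ v → 𝟙 (v ≤ᵇ l) ⊛ f (suc v)) ≈⟨ +-cong refl (∑-upTo-𝟙≤ᵇ n l (λ v → f (suc v)) le) ⟩
      𝟙 true ⊛ f 0 ⊕ ∑ (upTo (suc l)) (λ u → 𝟙 true ⊛ f (suc u)) ≡⟨ P.sym (∑-upTo-suc (suc l) _) ⟩
      ∑ (upTo (suc (suc l))) (λ u → 𝟙 true ⊛ f u) ∎

    ∑-shift : (n h l : ℕ) (f : ℕ → Carrier) → suc l ≤ n →
      ∑ (upTo n) (λ v → 𝟙 (v + h ≤ᵇ l) ⊛ f (v + h)) ≈ ∑ (upTo (suc l)) (λ u → 𝟙 (h ≤ᵇ u) ⊛ f u)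
    ∑-shift n zero l f le = begin
      ∑ (upTo n) (λ v → 𝟙 (v + 0 ≤ᵇ l) ⊛ f (v + 0)) ≈⟨ ∑-cong (upTo n) (λ v → reflexive (P.cong (λ w → 𝟙 (w ≤ᵇ l) ⊛ f w) (ℕ.+-identityʳ v))) ⟩
      ∑ (upTo n) (λ v → 𝟙 (v ≤ᵇ l) ⊛ f v) ≈⟨ ∑-upTo-𝟙≤ᵇ n l f le ⟩
      ∑ (upTo (suc l)) (λ u → 𝟙 true ⊛ f u) ∎
    ∑-shift n (suc h) zero f le = begin
      ∑ (upTo n) (λ v → 𝟙 (v + suc h ≤ᵇ 0) ⊛ f (v + suc h))
        ≈⟨ ∑-cong (upTo n) (λ v → reflexive (P.cong (λ w → 𝟙 (w ≤ᵇ 0) ⊛ f w) (+-suc v h))) ⟩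
      ∑ (upTo n) (λ v → 𝟙 false ⊛ f (suc (v + h))) ≈⟨ ∑-zero (upTo n) (λ _ → zeroˡ _) ⟩
      0# ≈⟨ sym (trans (+-cong (zeroˡ _) refl) (+-identityˡ _)) ⟩
      𝟙 false ⊛ f 0 ⊕ 0# ∎
    ∑-shift (suc n) (suc h) (suc l) f (s≤s le) = begin
      ∑ (upTo (suc n)) (λ v → 𝟙 (v + suc h ≤ᵇ suc l) ⊛ f (v + suc h))
        ≈⟨ ∑-cong (upTo (suc n)) (λ v → reflexive (P.cong (λ w → 𝟙 (w ≤ᵇ suc l) ⊛ f w) (+-suc v h))) ⟩
      ∑ (upTo (suc n)) (λ v → 𝟙 (suc (v + h) ≤ᵇ suc l) ⊛ f (suc (v + h)))
        ≈⟨ ∑-cong (upTo (suc n)) (λ v → *-cong (reflexive (P.cong 𝟙 (≤ᵇ-suc (v + h) l))) refl) ⟩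
      ∑ (upTo (suc n)) (λ v → 𝟙 (v + h ≤ᵇ l) ⊛ f (suc (v + h))) ≈⟨ ∑-shift (suc n) h l (λ w → f (suc w)) (m≤n⇒m≤1+n le) ⟩
      ∑ (upTo (suc l)) (λ u → 𝟙 (h ≤ᵇ u) ⊛ f (suc u)) ≈⟨ sym (+-identityˡ _) ⟩
      0# ⊕ ∑ (upTo (suc l)) (λ u → 𝟙 (h ≤ᵇ u) ⊛ f (suc u)) ≈⟨ +-cong (sym (zeroˡ _)) refl ⟩
      𝟙 false ⊛ f 0 ⊕ ∑ (upTo (suc l)) (λ u → 𝟙 (h ≤ᵇ u) ⊛ f (suc u))
        ≈⟨ +-cong refl (∑-cong (upTo (suc l)) (λ u → *-cong (reflexive (P.cong 𝟙 (P.sym (≤ᵇ-suc h u)))) refl)) ⟩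
      𝟙 false ⊛ f 0 ⊕ ∑ (upTo (suc l)) (λ u → 𝟙 (suc h ≤ᵇ suc u) ⊛ f (suc u)) ≡⟨ P.sym (∑-upTo-suc (suc l) _) ⟩
      ∑ (upTo (suc (suc l))) (λ u → 𝟙 (suc h ≤ᵇ u) ⊛ f u) ∎

    ∑-suffixSums-∷ : (M l : ℕ) (Ms L′ : List ℕ) (K : List ℕ → Carrier) →
      ∑ (boxChoices (M ∷ Ms)) (λ v → 𝟙 (pointwise≤ᵇ (suffixSums v) (l ∷ L′)) ⊛ K (suffixSums v))
        ≈ ∑ (boxChoices Ms) (λ v′ → 𝟙 (pointwise≤ᵇ (suffixSums v′) L′)
                       ⊛ ∑ (upTo (suc M)) (λ v₁ → 𝟙 (v₁ + head₀ (suffixSums v′) ≤ᵇ l) ⊛ K ((v₁ + head₀ (suffixSums v′)) ∷ suffixSums v′)))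
    ∑-suffixSums-∷ M l Ms L′ K = begin
      ∑ (boxChoices (M ∷ Ms)) (λ v → 𝟙 (pointwise≤ᵇ (suffixSums v) (l ∷ L′)) ⊛ K (suffixSums v))
        ≈⟨ ∑-boxChoices-∷ M Ms _ ⟩
      ∑ (upTo (suc M)) (λ v₁ → ∑ (boxChoices Ms) (λ v′ → 𝟙 ((v₁ + h v′ ≤ᵇ l) ∧ pointwise≤ᵇ (suffixSums v′) L′) ⊛ K′ v₁ v′))
        ≈⟨ ∑-cong (upTo (suc M)) (λ v₁ → ∑-cong (boxChoices Ms) (λ v′ → trans (*-cong (𝟙-∧ (v₁ + h v′ ≤ᵇ l) _) refl) (xy∙z≈y∙xz _ _ _))) ⟩
      ∑ (upTo (suc M)) (λ v₁ → ∑ (boxChoices Ms) (λ v′ → 𝟙 (pointwise≤ᵇ (suffixSums v′) L′) ⊛ (𝟙 (v₁ + h v′ ≤ᵇ l) ⊛ K′ v₁ v′)))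
        ≈⟨ ∑-swap (upTo (suc M)) (boxChoices Ms) _ ⟩
      ∑ (boxChoices Ms) (λ v′ → ∑ (upTo (suc M)) (λ v₁ → 𝟙 (pointwise≤ᵇ (suffixSums v′) L′) ⊛ (𝟙 (v₁ + h v′ ≤ᵇ l) ⊛ K′ v₁ v′)))
        ≈⟨ ∑-cong (boxChoices Ms) (λ v′ → sym (∑-*ˡ _ (upTo (suc M)) _)) ⟩
      ∑ (boxChoices Ms) (λ v′ → 𝟙 (pointwise≤ᵇ (suffixSums v′) L′) ⊛ ∑ (upTo (suc M)) (λ v₁ → 𝟙 (v₁ + h v′ ≤ᵇ l) ⊛ K′ v₁ v′)) ∎
      where
      h : List ℕ → ℕ
      h v′ = head₀ (suffixSums v′)
      K′ : ℕ → List ℕ → Carrier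
      K′ v₁ v′ = K ((v₁ + h v′) ∷ suffixSums v′)

    ∑-decreasing-∷ : (l : ℕ) (L′ : List ℕ) (K : List ℕ → Carrier) →
      ∑ (boxChoices L′) (λ u′ → 𝟙 (decreasingᵇ u′) ⊛ ∑ (upTo (suc l)) (λ u₁ → 𝟙 (head₀ u′ ≤ᵇ u₁) ⊛ K (u₁ ∷ u′)))
        ≈ ∑ (boxChoices (l ∷ L′)) (λ u → 𝟙 (decreasingᵇ u) ⊛ K u)
    ∑-decreasing-∷ l L′ K = begin
      ∑ (boxChoices L′) (λ u′ → 𝟙 (decreasingᵇ u′) ⊛ ∑ (upTo (suc l)) (λ u₁ → 𝟙 (head₀ u′ ≤ᵇ u₁) ⊛ K (u₁ ∷ u′)))
        ≈⟨ ∑-cong (boxChoices L′) (λ u′ → ∑-*ˡ _ (upTo (suc l)) _) ⟩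
      ∑ (boxChoices L′) (λ u′ → ∑ (upTo (suc l)) (λ u₁ → 𝟙 (decreasingᵇ u′) ⊛ (𝟙 (head₀ u′ ≤ᵇ u₁) ⊛ K (u₁ ∷ u′))))
        ≈⟨ ∑-swap (boxChoices L′) (upTo (suc l)) _ ⟩
      ∑ (upTo (suc l)) (λ u₁ → ∑ (boxChoices L′) (λ u′ → 𝟙 (decreasingᵇ u′) ⊛ (𝟙 (head₀ u′ ≤ᵇ u₁) ⊛ K (u₁ ∷ u′))))
        ≈⟨ ∑-cong (upTo (suc l)) (λ u₁ → ∑-cong (boxChoices L′) (λ u′ → sym (trans (*-cong (𝟙-decreasingᵇ-∷ u₁ u′) refl) (xy∙z≈y∙xz _ _ _)))) ⟩
      ∑ (upTo (suc l)) (λ u₁ → ∑ (boxChoices L′) (λ u′ → 𝟙 (decreasingᵇ (u₁ ∷ u′)) ⊛ K (u₁ ∷ u′)))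
        ≈⟨ sym (∑-boxChoices-∷ l L′ _) ⟩
      ∑ (boxChoices (l ∷ L′)) (λ u → 𝟙 (decreasingᵇ u) ⊛ K u) ∎
      where
      𝟙-decreasingᵇ-∷ : ∀ u₁ u′ → 𝟙 (decreasingᵇ (u₁ ∷ u′)) ≈ 𝟙 (head₀ u′ ≤ᵇ u₁) ⊛ 𝟙 (decreasingᵇ u′)
      𝟙-decreasingᵇ-∷ u₁ u′ = trans (reflexive (P.cong 𝟙 (decreasingᵇ-∷ u₁ u′))) (𝟙-∧ (head₀ u′ ≤ᵇ u₁) (decreasingᵇ u′))

    -- A label vector v ∈ [0,M]^L is determined by its suffix sums U, and these range
    -- exactly over the decreasing vectors; the test U ≤ L restricts them to boxChoices L.
    ∑-suffixSums : (M : ℕ) (L : List ℕ) → All (_≤ M) L → (K : List ℕ → Carrier) →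
      ∑ (boxChoices (replicate (length L) M)) (λ v → 𝟙 (pointwise≤ᵇ (suffixSums v) L) ⊛ K (suffixSums v))
        ≈ ∑ (boxChoices L) (λ u → 𝟙 (decreasingᵇ u) ⊛ K u)
    ∑-suffixSums M [] [] K = refl
    ∑-suffixSums M (l ∷ L′) (l≤M ∷ L′≤M) K = begin
      ∑ (boxChoices (M ∷ replicate (length L′) M)) (λ v → 𝟙 (pointwise≤ᵇ (suffixSums v) (l ∷ L′)) ⊛ K (suffixSums v))
        ≈⟨ ∑-suffixSums-∷ M l (replicate (length L′) M) L′ K ⟩
      ∑ (boxChoices (replicate (length L′) M)) (λ v′ → 𝟙 (pointwise≤ᵇ (suffixSums v′) L′) ⊛ K′ (suffixSums v′))
        ≈⟨ ∑-suffixSums M L′ L′≤M K′ ⟩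
      ∑ (boxChoices L′) (λ u′ → 𝟙 (decreasingᵇ u′) ⊛ K′ u′)
        ≈⟨ ∑-cong (boxChoices L′) (λ u′ → *-cong refl (∑-shift (suc M) (head₀ u′) l (λ w → K (w ∷ u′)) (s≤s l≤M))) ⟩
      ∑ (boxChoices L′) (λ u′ → 𝟙 (decreasingᵇ u′) ⊛ ∑ (upTo (suc l)) (λ u₁ → 𝟙 (head₀ u′ ≤ᵇ u₁) ⊛ K (u₁ ∷ u′)))
        ≈⟨ ∑-decreasing-∷ l L′ K ⟩
      ∑ (boxChoices (l ∷ L′)) (λ u → 𝟙 (decreasingᵇ u) ⊛ K u) ∎
      where
      K′ : List ℕ → Carrier
      K′ U = ∑ (upTo (suc M)) (λ v₁ → 𝟙 (v₁ + head₀ U ≤ᵇ l) ⊛ K ((v₁ + head₀ U) ∷ U))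


module RowWeight where

  open import Defs
  open FiniteSums
  open NatBool
  open PartitionLists using (head₀; Decreasing; Decreasing-head₀)
  open SuffixSums using (suffixSums; pointwise≤ᵇ; differences; pointwise≤ᵇ-head; head₀-≤)
  open import Data.List.Relation.Unary.Linked as Linked using ()
  open import Level using (Level)
  open import Data.Bool using (Bool; true; false; if_then_else_; _∧_)
  open import Data.Bool.Properties using (∧-zeroʳ; ∧-identityʳ)
  open import Data.Nat using (ℕ; zero; suc; _+_; _∸_; _≤_; _<_; _≤ᵇ_; _<ᵇ_; _≡ᵇ_; s≤s)
  open import Data.Nat.Properties using (≤-trans; m∸n≤m; m+n∸n≡m; suc-injective)
  open import Data.List using (List; []; _∷_; upTo; length)
  open import Data.List.Relation.Unary.All using (All; []; _∷_)
  open import Relation.Binary.PropositionalEquality as P using (_≡_)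
  open import Algebra.Bundles using (CommutativeRing)
  open import Data.Product using (proj₂)

  module Weights {c ℓ : Level} (R : CommutativeRing c ℓ) (α β x : CommutativeRing.Carrier R) where
    open CommutativeRing R hiding (zero) renaming (_+_ to _⊕_; _*_ to _⊛_)
    open Sums R
    open import Relation.Binary.Reasoning.Setoid setoid

    w : ℕ → ℕ → ℕ → ℕ → Carrier
    w = weight R α β x

    weightCase : Bool → Bool → ℕ → ℕ → Carrier
    weightCase b1 b2 a d = if b1 then 1#
             else if b2 then β ⊛ pow R (α ⊕ β) (a ∸ d ∸ 1) ⊛ pow R (x ⊕ α) d
             else x ⊛ pow R (x ⊕ α) (a ∸ 1)

    weightValue : ℕ → ℕ → Carrier
    weightValue a d = weightCase (a ≡ᵇ 0) (d <ᵇ a) a d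

    when : Bool → Carrier → Carrier
    when b X = if b then X else 0#

    -- The weight of a row whose j-th site has left label L_j ∸ U_j, bottom label U_j ∸ U_{j+1}
    -- and top label L_j ∸ L_{j+1}; for L, U the parts of λ, μ this is the row λ/μ.
    rowWeight : List ℕ → List ℕ → Carrier
    rowWeight [] _ = 1#
    rowWeight (l ∷ L) [] = 1#
    rowWeight (l ∷ L) (u ∷ U) = w (l ∸ u) (u ∸ head₀ U) (head₀ L ∸ head₀ U) (l ∸ head₀ L) ⊛ rowWeight L U

    weight-conservation : ∀ a v h hl l → h ≤ hl → hl ≤ l →
      w a v (hl ∸ h) (l ∸ hl) ≈ 𝟙 ((v + h ≤ᵇ l) ∧ (a ≡ᵇ l ∸ (v + h))) ⊛ w (l ∸ (v + h)) ((v + h) ∸ h) (hl ∸ h) (l ∸ hl)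
    weight-conservation a v h hl l p q with (v + h ≤ᵇ l) ∧ (a ≡ᵇ l ∸ (v + h)) in eqB
    ... | false = begin
        w a v (hl ∸ h) (l ∸ hl) ≡⟨ P.cong (λ t → when t (weightValue a (l ∸ hl))) (P.trans (P.cong (a + v ≡ᵇ_) (∸-telescope h hl l p q)) (P.trans (≡ᵇ-∸-split a v h l (≤-trans p q)) eqB)) ⟩
        0# ≈⟨ sym (zeroˡ _) ⟩
        0# ⊛ _ ∎
    ... | true with ≡ᵇ→≡ a (l ∸ (v + h)) (proj₂ (∧-true⁻ {v + h ≤ᵇ l} eqB))
    ...   | P.refl = begin
        w a v (hl ∸ h) (l ∸ hl) ≡⟨ P.cong (λ t → w a t (hl ∸ h) (l ∸ hl)) (P.sym (m+n∸n≡m v h)) ⟩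
        w a ((v + h) ∸ h) (hl ∸ h) (l ∸ hl) ≈⟨ sym (*-identityˡ _) ⟩
        1# ⊛ w a ((v + h) ∸ h) (hl ∸ h) (l ∸ hl) ∎

    module _ (M : ℕ) where
      rF : ℕ → List ℕ → List ℕ → Carrier
      rF = rowFrom R α β M x

      -- Conservation a + b = c + d forces the left label at site j to be L_j ∸ U_j with U = suffixSums v.
      rowFrom-differences : (L v : List ℕ) → length v ≡ length L → All (_≤ M) L → Decreasing L → (a : ℕ) →
        rF a v (differences L) ≈ 𝟙 (pointwise≤ᵇ (suffixSums v) L ∧ (a ≡ᵇ (head₀ L ∸ head₀ (suffixSums v)))) ⊛ rowWeight L (suffixSums v)
      rowFrom-differences [] [] e al dL a = sym (*-identityʳ _)
      rowFrom-differences (l ∷ L′) (v1 ∷ v′) e (l≤M ∷ al) dL a with pointwise≤ᵇ (suffixSums v′) L′ in eqS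
      ... | false = begin
          ∑ (upTo (suc M)) (λ c → w a v1 c (l ∸ head₀ L′) ⊛ rF c v′ (differences L′))
            ≈⟨ ∑-zero (upTo (suc M)) (λ c → trans (*-cong refl (trans (rowFrom-differences L′ v′ (suc-injective e) al (Linked.tail dL) c) (*-cong (reflexive (P.cong 𝟙 (P.cong (_∧ (c ≡ᵇ head₀ L′ ∸ head₀ (suffixSums v′))) eqS))) refl))) (trans (*-cong refl (zeroˡ _)) (zeroʳ _))) ⟩
          0# ≈⟨ sym (zeroˡ _) ⟩
          𝟙 false ⊛ rowWeight (l ∷ L′) (suffixSums (v1 ∷ v′)) ≡⟨ P.cong (λ t → 𝟙 t ⊛ rowWeight (l ∷ L′) (suffixSums (v1 ∷ v′))) (P.sym (P.cong (_∧ (a ≡ᵇ l ∸ (v1 + h))) (∧-zeroʳ (v1 + h ≤ᵇ l)))) ⟩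
          𝟙 (((v1 + h ≤ᵇ l) ∧ false) ∧ (a ≡ᵇ l ∸ (v1 + h))) ⊛ rowWeight (l ∷ L′) (suffixSums (v1 ∷ v′)) ∎
        where h = head₀ (suffixSums v′)
      ... | true = begin
          ∑ (upTo (suc M)) (λ c → w a v1 c (l ∸ hl) ⊛ rF c v′ (differences L′))
            ≈⟨ ∑-cong (upTo (suc M)) (λ c → *-cong refl (trans (rowFrom-differences L′ v′ (suc-injective e) al (Linked.tail dL) c) (*-cong (reflexive (P.cong (λ t → 𝟙 (t ∧ (c ≡ᵇ hl ∸ h))) eqS)) refl))) ⟩
          ∑ (upTo (suc M)) (λ c → w a v1 c (l ∸ hl) ⊛ (𝟙 (true ∧ (c ≡ᵇ hl ∸ h)) ⊛ Π′))
            ≈⟨ ∑-cong (upTo (suc M)) (λ c → trans (sym (*-assoc _ _ _)) (trans (*-cong (*-comm _ _) refl) (trans (*-assoc _ _ _) (*-cong (reflexive (P.cong 𝟙 (≡ᵇ-sym c (hl ∸ h)))) refl)))) ⟩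
          ∑ (upTo (suc M)) (λ c → 𝟙 (hl ∸ h ≡ᵇ c) ⊛ (w a v1 c (l ∸ hl) ⊛ Π′))
            ≈⟨ ∑-𝟙-≡ᵇ (suc M) (hl ∸ h) (λ c → w a v1 c (l ∸ hl) ⊛ Π′) (s≤s (≤-trans (m∸n≤m hl h) (head₀-≤ L′ al))) ⟩
          w a v1 (hl ∸ h) (l ∸ hl) ⊛ Π′
            ≈⟨ *-cong (weight-conservation a v1 h hl l (pointwise≤ᵇ-head (suffixSums v′) L′ eqS) (Decreasing-head₀ dL)) refl ⟩
          (𝟙 ((v1 + h ≤ᵇ l) ∧ (a ≡ᵇ l ∸ (v1 + h))) ⊛ w (l ∸ (v1 + h)) ((v1 + h) ∸ h) (hl ∸ h) (l ∸ hl)) ⊛ Π′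
            ≈⟨ *-assoc _ _ _ ⟩
          𝟙 ((v1 + h ≤ᵇ l) ∧ (a ≡ᵇ l ∸ (v1 + h))) ⊛ (w (l ∸ (v1 + h)) ((v1 + h) ∸ h) (hl ∸ h) (l ∸ hl) ⊛ Π′)
            ≡⟨ P.cong (λ t → 𝟙 (t ∧ (a ≡ᵇ l ∸ (v1 + h))) ⊛ (w (l ∸ (v1 + h)) ((v1 + h) ∸ h) (hl ∸ h) (l ∸ hl) ⊛ Π′)) (P.sym (∧-identityʳ (v1 + h ≤ᵇ l))) ⟩
          𝟙 (((v1 + h ≤ᵇ l) ∧ true) ∧ (a ≡ᵇ l ∸ (v1 + h))) ⊛ (w (l ∸ (v1 + h)) ((v1 + h) ∸ h) (hl ∸ h) (l ∸ hl) ⊛ Π′) ∎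
        where h = head₀ (suffixSums v′)
              hl = head₀ L′
              Π′ = rowWeight L′ (suffixSums v′)

      rowZ-differences : (L v : List ℕ) → length v ≡ length L → All (_≤ M) L → Decreasing L →
        rowZ R α β M x v (differences L) ≈ 𝟙 (pointwise≤ᵇ (suffixSums v) L) ⊛ rowWeight L (suffixSums v)
      rowZ-differences L v e al dL with pointwise≤ᵇ (suffixSums v) L in eqS
      ... | false = trans (∑-zero (upTo (suc M)) (λ a → trans (rowFrom-differences L v e al dL a) (trans (*-cong (reflexive (P.cong (λ t → 𝟙 (t ∧ (a ≡ᵇ (head₀ L ∸ head₀ (suffixSums v))))) eqS)) refl) (zeroˡ _)))) (sym (zeroˡ _))
      ... | true = begin
          ∑ (upTo (suc M)) (λ a → rF a v (differences L))
            ≈⟨ ∑-cong (upTo (suc M)) (λ a → trans (rowFrom-differences L v e al dL a) (*-cong (reflexive (P.cong (λ t → 𝟙 (t ∧ (a ≡ᵇ (head₀ L ∸ head₀ (suffixSums v))))) eqS)) refl)) ⟩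
          ∑ (upTo (suc M)) (λ a → 𝟙 (a ≡ᵇ (head₀ L ∸ head₀ (suffixSums v))) ⊛ rowWeight L (suffixSums v))
            ≈⟨ ∑-cong (upTo (suc M)) (λ a → *-cong (reflexive (P.cong 𝟙 (≡ᵇ-sym a (head₀ L ∸ head₀ (suffixSums v))))) refl) ⟩
          ∑ (upTo (suc M)) (λ a → 𝟙 ((head₀ L ∸ head₀ (suffixSums v)) ≡ᵇ a) ⊛ rowWeight L (suffixSums v))
            ≈⟨ ∑-𝟙-≡ᵇ (suc M) (head₀ L ∸ head₀ (suffixSums v)) (λ _ → rowWeight L (suffixSums v)) (s≤s (≤-trans (m∸n≤m (head₀ L) (head₀ (suffixSums v))) (head₀-≤ L al))) ⟩
          rowWeight L (suffixSums v) ≈⟨ sym (*-identityˡ _) ⟩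
          𝟙 true ⊛ rowWeight L (suffixSums v) ∎


module LocalExponents where

  open NatBool
  open import Data.Bool using (Bool; true; false; if_then_else_; _∧_; _∨_)
  open import Data.Bool.Properties using (¬-not)
  open import Data.Nat using (ℕ; suc; _+_; _∸_; _≤_; _<_; _≤ᵇ_; _<ᵇ_; _≡ᵇ_; _⊔_)
  open import Data.Nat.Properties
  open import Data.Product using (_×_; _,_)
  open import Data.Sum using (_⊎_; inj₁; inj₂)
  open import Relation.Nullary using (yes; no)
  open import Relation.Binary.PropositionalEquality

  expβ-by expαβ-by expx-by expαx-by : Bool → Bool → ℕ → ℕ → ℕ
  expβ-by b1 b2 a d = if b1 then 0 else if b2 then 1 else 0
  expαβ-by b1 b2 a d = if b1 then 0 else if b2 then a ∸ d ∸ 1 else 0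
  expx-by b1 b2 a d = if b1 then 0 else if b2 then 0 else 1
  expαx-by b1 b2 a d = if b1 then 0 else if b2 then d else a ∸ 1

  -- At site j of the row λ/μ: P = λ_j, Q = μ_j, P' = λ_{j+1}, so a = P ∸ Q and d = P ∸ P'.
  expβ expαβ expx expαx : ℕ → ℕ → ℕ → ℕ
  expβ P Q P' = expβ-by (P ∸ Q ≡ᵇ 0) ((P ∸ P') <ᵇ (P ∸ Q)) (P ∸ Q) (P ∸ P')
  expαβ P Q P' = expαβ-by (P ∸ Q ≡ᵇ 0) ((P ∸ P') <ᵇ (P ∸ Q)) (P ∸ Q) (P ∸ P')
  expx P Q P' = expx-by (P ∸ Q ≡ᵇ 0) ((P ∸ P') <ᵇ (P ∸ Q)) (P ∸ Q) (P ∸ P')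
  expαx P Q P' = expαx-by (P ∸ Q ≡ᵇ 0) ((P ∸ P') <ᵇ (P ∸ Q)) (P ∸ Q) (P ∸ P')

  count : Bool → ℕ
  count b = if b then 1 else 0

  rowOccupied : ℕ → ℕ → ℕ
  rowOccupied P Q = count (Q <ᵇ P)

  -- Row j of λ/μ is occupied, is the lowest row of a component, and holds the lowest cell of
  -- the columns (λ_{j+1} ⊔ μ_j, λ_j] respectively.
  componentStart : ℕ → ℕ → ℕ → ℕ
  componentStart P Q P' = count ((Q <ᵇ P) ∧ (P' ≤ᵇ Q))

  newColumns : ℕ → ℕ → ℕ → ℕ
  newColumns P Q P' = P ∸ (P' ⊔ Q)

  RowEmpty RowJoinsBelow RowStartsComponent : ℕ → ℕ → ℕ → Set
  RowEmpty P Q P' = (P ∸ Q ≡ 0) × ((Q <ᵇ P) ≡ false) × (P ∸ (P' ⊔ Q) ≡ 0)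
  RowJoinsBelow P Q P' = ((P ∸ Q ≡ᵇ 0) ≡ false) × (((P ∸ P') <ᵇ (P ∸ Q)) ≡ true) × ((Q <ᵇ P) ≡ true) × ((P' ≤ᵇ Q) ≡ false)
                 × (P ∸ (P' ⊔ Q) ≡ P ∸ P') × ((P ∸ P') < (P ∸ Q))
  RowStartsComponent P Q P' = ((P ∸ Q ≡ᵇ 0) ≡ false) × (((P ∸ P') <ᵇ (P ∸ Q)) ≡ false) × ((Q <ᵇ P) ≡ true) × ((P' ≤ᵇ Q) ≡ true)
                 × (P ∸ (P' ⊔ Q) ≡ P ∸ Q) × (0 < P ∸ Q)

  row-cases : ∀ P Q P' → Q ≤ P → P' ≤ P → RowEmpty P Q P' ⊎ RowJoinsBelow P Q P' ⊎ RowStartsComponent P Q P'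
  row-cases P Q P' q≤p p'≤p with m≤n⇒m<n∨m≡n q≤p
  ... | inj₂ refl = inj₁ (n∸n≡0 Q , <ᵇ-irrefl Q , trans (cong (Q ∸_) (m≤n⇒m⊔n≡n p'≤p)) (n∸n≡0 Q))
  ... | inj₁ q<p with Q <? P'
  ...   | yes q<p' = inj₂ (inj₁ (>0⇒≡ᵇ0-false (m<n⇒0<n∸m q<p) , <→<ᵇ _ _ dlt , <→<ᵇ _ _ q<p , ¬-not (λ e → <⇒≱ q<p' (≤ᵇ→≤ _ _ e))
                      , cong (P ∸_) (m≥n⇒m⊔n≡m (<⇒≤ q<p')) , dlt))
    where dlt = ∸-monoʳ-< {P} {P'} {Q} q<p' p'≤p
  ...   | no q≮p' = inj₂ (inj₂ (>0⇒≡ᵇ0-false (m<n⇒0<n∸m q<p) , ¬-not (λ e → <⇒≱ (<ᵇ→< _ _ e) (∸-monoʳ-≤ P p'≤q)) , <→<ᵇ _ _ q<p , ≤→≤ᵇ _ _ p'≤q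
                      , cong (P ∸_) (m≤n⇒m⊔n≡n p'≤q) , m<n⇒0<n∸m q<p))
    where p'≤q = ≮⇒≥ q≮p'

  a+0≡1+d+[a∸d∸1] : ∀ a d → d < a → a + 0 ≡ (1 + d) + (a ∸ d ∸ 1)
  a+0≡1+d+[a∸d∸1] a d lt = trans (+-identityʳ a) (sym (trans (cong (λ z → 1 + d + z) (trans (∸-+-assoc a d 1) (cong (a ∸_) (+-comm d 1)))) (m+[n∸m]≡n lt)))

  1+[a∸1]≡a : ∀ a → 0 < a → 1 + (a ∸ 1) ≡ a
  1+[a∸1]≡a (suc a) _ = refl

  expβ+expx≡rowOccupied : ∀ P Q P' → Q ≤ P → P' ≤ P → expβ P Q P' + expx P Q P' ≡ rowOccupied P Q
  expβ+expx≡rowOccupied P Q P' a b with row-cases P Q P' a b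
  ... | inj₁ (e1 , e2 , e3) rewrite e1 | e2 = refl
  ... | inj₂ (inj₁ (e1 , e2 , e3 , e4 , e5 , e6)) rewrite e1 | e2 | e3 = refl
  ... | inj₂ (inj₂ (e1 , e2 , e3 , e4 , e5 , e6)) rewrite e1 | e2 | e3 = refl

  expx≡componentStart : ∀ P Q P' → Q ≤ P → P' ≤ P → expx P Q P' ≡ componentStart P Q P'
  expx≡componentStart P Q P' a b with row-cases P Q P' a b
  ... | inj₁ (e1 , e2 , e3) rewrite e1 | e2 = refl
  ... | inj₂ (inj₁ (e1 , e2 , e3 , e4 , e5 , e6)) rewrite e1 | e2 | e3 | e4 = refl
  ... | inj₂ (inj₂ (e1 , e2 , e3 , e4 , e5 , e6)) rewrite e1 | e2 | e3 | e4 = refl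

  expx+expαx≡newColumns : ∀ P Q P' → Q ≤ P → P' ≤ P → expx P Q P' + expαx P Q P' ≡ newColumns P Q P'
  expx+expαx≡newColumns P Q P' a b with row-cases P Q P' a b
  ... | inj₁ (e1 , e2 , e3) rewrite e1 | e3 = refl
  ... | inj₂ (inj₁ (e1 , e2 , e3 , e4 , e5 , e6)) rewrite e1 | e2 | e5 = refl
  ... | inj₂ (inj₂ (e1 , e2 , e3 , e4 , e5 , e6)) rewrite e1 | e2 | e5 = 1+[a∸1]≡a (P ∸ Q) e6

  cells+expx≡rowOccupied+newColumns+expαβ : ∀ P Q P' → Q ≤ P → P' ≤ P → (P ∸ Q) + expx P Q P' ≡ (rowOccupied P Q + newColumns P Q P') + expαβ P Q P'
  cells+expx≡rowOccupied+newColumns+expαβ P Q P' a b with row-cases P Q P' a b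
  ... | inj₁ (e1 , e2 , e3) rewrite e1 | e2 | e3 = refl
  ... | inj₂ (inj₁ (e1 , e2 , e3 , e4 , e5 , e6)) rewrite e1 | e2 | e3 | e5 = a+0≡1+d+[a∸d∸1] (P ∸ Q) (P ∸ P') e6
  ... | inj₂ (inj₂ (e1 , e2 , e3 , e4 , e5 , e6)) rewrite e1 | e2 | e3 | e5 = trans (+-comm (P ∸ Q) 1) (sym (+-identityʳ _))


module RowMonomial where

  open import Defs
  open NatBool
  open PartitionLists using (head₀; parts)
  open RowWeight
  open LocalExponents
  open NatSums
  open import Level using (Level)
  open import Data.Bool using (true; false)
  open import Data.Nat using (ℕ; zero; suc; _+_; _∸_; _≤_; _<_; _<ᵇ_; _≡ᵇ_)
  import Data.Nat.Properties as NP
  open import Data.List using (map; applyUpTo)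
  open import Relation.Binary.PropositionalEquality as P using (_≡_)
  open import Algebra.Bundles using (CommutativeRing)

  module Monomials {c ℓ : Level} (R : CommutativeRing c ℓ) (α β x : CommutativeRing.Carrier R) where
    open CommutativeRing R hiding (zero) renaming (_+_ to _⊕_; _*_ to _⊛_)
    open import Relation.Binary.Reasoning.Setoid setoid
    open Weights R α β x
    open import Algebra.Properties.CommutativeSemigroup *-commutativeSemigroup using (interchange)

    pw : Carrier → ℕ → Carrier
    pw = pow R

    pow-+ : ∀ y m n → pw y (m + n) ≈ pw y m ⊛ pw y n
    pow-+ y zero n = sym (*-identityˡ _)
    pow-+ y (suc m) n = trans (*-cong refl (pow-+ y m n)) (sym (*-assoc _ _ _))

    pow-cong : ∀ {y z} n → y ≈ z → pw y n ≈ pw z n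
    pow-cong zero e = refl
    pow-cong (suc n) e = *-cong e (pow-cong n e)

    monomial : ℕ → ℕ → ℕ → ℕ → Carrier
    monomial e1 e2 e3 e4 = ((pw β e1 ⊛ pw (α ⊕ β) e2) ⊛ pw x e3) ⊛ pw (α ⊕ x) e4

    monomial-cong : ∀ {a b c d a′ b′ c′ d′} → a ≡ a′ → b ≡ b′ → c ≡ c′ → d ≡ d′ → monomial a b c d ≈ monomial a′ b′ c′ d′
    monomial-cong P.refl P.refl P.refl P.refl = refl

    *-interchange4 : ∀ a b c d a′ b′ c′ d′ → (((a ⊛ b) ⊛ c) ⊛ d) ⊛ (((a′ ⊛ b′) ⊛ c′) ⊛ d′) ≈ (((a ⊛ a′) ⊛ (b ⊛ b′)) ⊛ (c ⊛ c′)) ⊛ (d ⊛ d′)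
    *-interchange4 a b c d a′ b′ c′ d′ =
      trans (interchange _ d _ d′) (*-cong (trans (interchange _ c _ c′) (*-cong (interchange a b a′ b′) refl)) refl)

    monomial-* : ∀ a b c d a′ b′ c′ d′ → monomial a b c d ⊛ monomial a′ b′ c′ d′ ≈ monomial (a + a′) (b + b′) (c + c′) (d + d′)
    monomial-* a b c d a′ b′ c′ d′ = trans (*-interchange4 _ _ _ _ _ _ _ _)
      (sym (*-cong (*-cong (*-cong (pow-+ β a a′) (pow-+ (α ⊕ β) b b′)) (pow-+ x c c′)) (pow-+ (α ⊕ x) d d′)))

    monomial-zero : monomial 0 0 0 0 ≈ 1#
    monomial-zero = trans (*-identityʳ _) (trans (*-identityʳ _) (*-identityʳ _))

    weightCase-monomial : ∀ b1 b2 a d → weightCase b1 b2 a d ≈ monomial (expβ-by b1 b2 a d) (expαβ-by b1 b2 a d) (expx-by b1 b2 a d) (expαx-by b1 b2 a d)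
    weightCase-monomial true b2 a d = sym monomial-zero
    weightCase-monomial false true a d = sym (*-cong (trans (*-identityʳ _) (*-cong (*-identityʳ β) refl)) (pow-cong d (+-comm α x)))
    weightCase-monomial false false a d = sym (*-cong (trans (*-cong (*-identityʳ 1#) (*-identityʳ x)) (*-identityˡ x)) (pow-cong (a ∸ 1) (+-comm α x)))

    head₀-parts : ∀ (p f : ℕ → ℕ) k → (∀ t → f (suc t) ≡ suc (f t)) → p (f (suc k)) ≡ 0 →
      head₀ (map p (applyUpTo (λ t → f (suc t)) k)) ≡ p (suc (f 0))
    head₀-parts p f zero ef z = P.sym (P.trans (P.cong p (P.sym (ef 0))) z)
    head₀-parts p f (suc k) ef z = P.cong p (ef 0)

    rowWeight-monomial : ∀ (p q f : ℕ → ℕ) k → (∀ t → f (suc t) ≡ suc (f t)) → p (f k) ≡ 0 → q (f k) ≡ 0 →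
      (∀ j → q j ≤ p j) → (∀ t → p (suc (f t)) ≤ p (f t)) → (∀ t → q (suc (f t)) ≤ q (f t)) →
      rowWeight (map p (applyUpTo f k)) (map q (applyUpTo f k))
        ≈ monomial (sumBelow (λ t → expβ (p (f t)) (q (f t)) (p (suc (f t)))) k)
               (sumBelow (λ t → expαβ (p (f t)) (q (f t)) (p (suc (f t)))) k)
               (sumBelow (λ t → expx (p (f t)) (q (f t)) (p (suc (f t)))) k)
               (sumBelow (λ t → expαx (p (f t)) (q (f t)) (p (suc (f t)))) k)
    rowWeight-monomial p q f zero ef zp zq qp pd qd = sym monomial-zero
    rowWeight-monomial p q f (suc k) ef zp zq qp pd qd = trans (begin
      w (P ∸ Q) (Q ∸ head₀ Ur) (head₀ Lr ∸ head₀ Ur) (P ∸ head₀ Lr) ⊛ rowWeight Lr Ur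
        ≡⟨ P.cong₂ (λ a b → w (P ∸ Q) (Q ∸ b) (a ∸ b) (P ∸ a) ⊛ rowWeight Lr Ur) (head₀-parts p f k ef zp) (head₀-parts q f k ef zq) ⟩
      w (P ∸ Q) (Q ∸ Q′) (P′ ∸ Q′) (P ∸ P′) ⊛ rowWeight Lr Ur
        ≡⟨ P.cong (λ t → when t (weightValue (P ∸ Q) (P ∸ P′)) ⊛ rowWeight Lr Ur) (≡→≡ᵇ _ _ conservation) ⟩
      weightCase (P ∸ Q ≡ᵇ 0) ((P ∸ P′) <ᵇ (P ∸ Q)) (P ∸ Q) (P ∸ P′) ⊛ rowWeight Lr Ur ∎)
        (trans (*-cong (weightCase-monomial (P ∸ Q ≡ᵇ 0) ((P ∸ P′) <ᵇ (P ∸ Q)) (P ∸ Q) (P ∸ P′)) (rowWeight-monomial p q (λ t → f (suc t)) k (λ t → ef (suc t)) zp zq qp (λ t → pd (suc t)) (λ t → qd (suc t))))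
          (monomial-* (gB 0) (gE 0) (gY 0) (gC 0) (sumBelow (λ t → gB (suc t)) k) (sumBelow (λ t → gE (suc t)) k) (sumBelow (λ t → gY (suc t)) k) (sumBelow (λ t → gC (suc t)) k)))
      where
      P = p (f 0)
      Q = q (f 0)
      P′ = p (suc (f 0))
      Q′ = q (suc (f 0))
      gB gE gY gC : ℕ → ℕ
      gB t = expβ (p (f t)) (q (f t)) (p (suc (f t)))
      gE t = expαβ (p (f t)) (q (f t)) (p (suc (f t)))
      gY t = expx (p (f t)) (q (f t)) (p (suc (f t)))
      gC t = expαx (p (f t)) (q (f t)) (p (suc (f t)))
      Lr = map p (applyUpTo (λ t → f (suc t)) k)
      Ur = map q (applyUpTo (λ t → f (suc t)) k)
      conservation : (P ∸ Q) + (Q ∸ Q′) ≡ (P′ ∸ Q′) + (P ∸ P′)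
      conservation = P.trans (NP.+-comm (P ∸ Q) (Q ∸ Q′)) (P.trans (∸-telescope Q′ Q P (qd 0) (qp (f 0))) (P.sym (∸-telescope Q′ P′ P (qp (suc (f 0))) (pd 0))))

    rowWeight≈gSkew-from-counts : ∀ λ′ μ W →
      part λ′ (suc W) ≡ 0 → part μ (suc W) ≡ 0 → (∀ j → part μ j ≤ part λ′ j) →
      (∀ t → part λ′ (suc (suc t)) ≤ part λ′ (suc t)) → (∀ t → part μ (suc (suc t)) ≤ part μ (suc t)) →
      rowsOf λ′ μ ≡ sumBelow (λ t → rowOccupied (part λ′ (suc t)) (part μ (suc t))) W →
      compsOf λ′ μ ≡ sumBelow (λ t → componentStart (part λ′ (suc t)) (part μ (suc t)) (part λ′ (suc (suc t)))) W →
      colsOf λ′ μ ≡ sumBelow (λ t → newColumns (part λ′ (suc t)) (part μ (suc t)) (part λ′ (suc (suc t)))) W →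
      size λ′ ∸ size μ ≡ sumBelow (λ t → part λ′ (suc t) ∸ part μ (suc t)) W →
      rowWeight (parts W λ′) (parts W μ) ≈ gSkew R α β λ′ μ x
    rowWeight≈gSkew-from-counts λ′ μ W zp zq qp pd qd hr hb hc hs =
      trans (rowWeight-monomial p q suc W (λ _ → P.refl) zp zq qp pd qd) (monomial-cong β-total αβ-total x-total αx-total)
      where
      p = part λ′
      q = part μ
      gB gE gY gC : ℕ → ℕ
      gB t = expβ (p (suc t)) (q (suc t)) (p (suc (suc t)))
      gE t = expαβ (p (suc t)) (q (suc t)) (p (suc (suc t)))
      gY t = expx (p (suc t)) (q (suc t)) (p (suc (suc t)))
      gC t = expαx (p (suc t)) (q (suc t)) (p (suc (suc t)))
      r = rowsOf λ′ μ
      b = compsOf λ′ μ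
      c′ = colsOf λ′ μ
      cellCount = size λ′ ∸ size μ
      x-total : sumBelow gY W ≡ b
      x-total = P.trans (sumBelow-cong gY _ W (λ t → expx≡componentStart (p (suc t)) (q (suc t)) (p (suc (suc t))) (qp (suc t)) (pd t))) (P.sym hb)
      rows-split : r ≡ sumBelow gB W + sumBelow gY W
      rows-split = P.trans hr (P.trans (sumBelow-cong _ (λ t → gB t + gY t) W (λ t → P.sym (expβ+expx≡rowOccupied (p (suc t)) (q (suc t)) (p (suc (suc t))) (qp (suc t)) (pd t)))) (sumBelow-+ gB gY W))
      cols-split : c′ ≡ sumBelow gY W + sumBelow gC W
      cols-split = P.trans hc (P.trans (sumBelow-cong _ (λ t → gY t + gC t) W (λ t → P.sym (expx+expαx≡newColumns (p (suc t)) (q (suc t)) (p (suc (suc t))) (qp (suc t)) (pd t)))) (sumBelow-+ gY gC W))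
      β-total : sumBelow gB W ≡ r ∸ b
      β-total = P.sym (P.trans (P.cong₂ _∸_ rows-split (P.sym x-total)) (NP.m+n∸n≡m (sumBelow gB W) (sumBelow gY W)))
      αx-total : sumBelow gC W ≡ c′ ∸ b
      αx-total = P.sym (P.trans (P.cong₂ _∸_ cols-split (P.sym x-total)) (NP.m+n∸m≡n (sumBelow gY W) (sumBelow gC W)))
      cells-balance : cellCount + b ≡ (r + c′) + sumBelow gE W
      cells-balance = P.trans (P.cong₂ _+_ hs (P.sym x-total)) (P.trans (P.sym (sumBelow-+ _ gY W))
        (P.trans (sumBelow-cong _ _ W (λ t → cells+expx≡rowOccupied+newColumns+expαβ (p (suc t)) (q (suc t)) (p (suc (suc t))) (qp (suc t)) (pd t)))
        (P.trans (sumBelow-+ _ gE W) (P.trans (P.cong (_+ sumBelow gE W) (sumBelow-+ _ _ W))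
          (P.cong (_+ sumBelow gE W) (P.cong₂ _+_ (P.sym hr) (P.sym hc)))))))
      αβ-total : sumBelow gE W ≡ (cellCount + b) ∸ (r + c′)
      αβ-total = P.sym (P.trans (P.cong (_∸ (r + c′)) cells-balance) (NP.m+n∸m≡n (r + c′) (sumBelow gE W)))


module ShapeCounts where

  open import Defs
  open NatBool
  open PartitionLists
  open LocalExponents
  open NatSums
  open import Data.Bool using (Bool; true; false; if_then_else_; _∧_; _∨_)
  open import Data.Bool.Properties using (¬-not; ∧-identityʳ; ∨-identityʳ)
  open import Data.Nat using (ℕ; zero; suc; _+_; _∸_; _≤_; _<_; _≤ᵇ_; _<ᵇ_; _≡ᵇ_; z≤n; s≤s; s≤s⁻¹; _⊔_)
  open import Data.Nat.Properties
  open import Data.Nat.ListAction using (sum)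
  open import Data.List using (List; []; _∷_; map; upTo; length; applyUpTo)
  open import Data.List.Relation.Unary.All as All using ([]; _∷_)
  open import Data.List.Relation.Unary.Any as Any using (Any)
  open import Data.List.Relation.Unary.Linked using ([]; _∷_)
  open import Data.List.Membership.Propositional using (_∈_; find)
  open import Data.List.Membership.Propositional.Properties using (∈-map⁻; ∈-map⁺; ∈-concatMap⁻; ∈-concatMap⁺; ∈-upTo⁺; ∈-upTo⁻)
  open import Data.Product using (_×_; _,_; proj₁; proj₂; ∃)
  open import Data.Sum using (inj₁; inj₂)
  open import Data.Empty using (⊥; ⊥-elim)
  open import Relation.Nullary using (¬_; yes; no)
  open import Relation.Binary.PropositionalEquality

  length-filt-applyUpTo : ∀ (P : ℕ → Bool) (f : ℕ → ℕ) k → length (filt P (applyUpTo f k)) ≡ sumBelow (λ t → count (P (f t))) k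
  length-filt-applyUpTo P f zero = refl
  length-filt-applyUpTo P f (suc k) with P (f 0)
  ... | true = cong suc (length-filt-applyUpTo P (λ t → f (suc t)) k)
  ... | false = length-filt-applyUpTo P (λ t → f (suc t)) k

  sum≡sumBelow-parts : ∀ xs k → length xs ≤ k → sum xs ≡ sumBelow (λ t → part xs (suc t)) k
  sum≡sumBelow-parts [] k _ = sym (sumBelow-zero _ k (λ _ → refl))
  sum≡sumBelow-parts (a ∷ xs) (suc k) (s≤s le) = cong (a +_) (trans (sum≡sumBelow-parts xs k le) (sumBelow-cong _ _ k (λ t → sym (part-cons a xs t))))

  module SkewCells (λ′ μ : List ℕ) where
    p = part λ′
    q = part μ
    ℓ′ = length λ′
    cells = skewCells λ′ μ

    ∈-skewCells⁻ : ∀ {y} → y ∈ cells → ∃ λ t → (Cell.row y ≡ suc t) × (t < ℓ′) × (q (suc t) < Cell.col y) × (Cell.col y ≤ p (suc t))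
    ∈-skewCells⁻ {y} m with find (∈-concatMap⁻ (λ i → map (λ j → cell (suc i) (suc j)) (filt (λ j → q (suc i) <ᵇ suc j) (upTo (p (suc i))))) {xs = upTo ℓ′} m)
    ... | t , tm , m2 with ∈-map⁻ (λ j → cell (suc t) (suc j)) m2
    ... | j , jm , refl with ∈-filt⁻ (upTo (p (suc t))) jm
    ... | jm2 , e = t , refl , ∈-upTo⁻ tm , <ᵇ→< _ _ e , ∈-upTo⁻ jm2

    ∈-skewCells⁺ : ∀ t j → t < ℓ′ → q (suc t) < suc j → suc j ≤ p (suc t) → cell (suc t) (suc j) ∈ cells
    ∈-skewCells⁺ t j tl ql jl = ∈-concatMap⁺ (λ i → map (λ j → cell (suc i) (suc j)) (filt (λ j → q (suc i) <ᵇ suc j) (upTo (p (suc i))))) (Any.map (λ { refl → ∈-map⁺ (λ j → cell (suc t) (suc j)) (∈-filt⁺ _ (upTo (p (suc t))) (∈-upTo⁺ jl) (<→<ᵇ _ _ ql)) }) (∈-upTo⁺ tl))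

    anyᵇ-row≡<ᵇ : ∀ t → t < ℓ′ → anyᵇ (λ y → Cell.row y ≡ᵇ suc t) cells ≡ (q (suc t) <ᵇ p (suc t))
    anyᵇ-row≡<ᵇ t tl = bool-iff _ _ fw bw
      where
      fw : anyᵇ (λ y → Cell.row y ≡ᵇ suc t) cells ≡ true → (q (suc t) <ᵇ p (suc t)) ≡ true
      fw e with anyᵇ⁻ (λ y → Cell.row y ≡ᵇ suc t) cells e
      ... | y , m , ey with ∈-skewCells⁻ m
      ... | t′ , er , _ , ql , jl with trans (sym er) (≡ᵇ→≡ _ _ ey)
      ... | refl = <→<ᵇ _ _ (<-≤-trans ql jl)
      bw : (q (suc t) <ᵇ p (suc t)) ≡ true → anyᵇ (λ y → Cell.row y ≡ᵇ suc t) cells ≡ true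
      bw e = row-has-cell (p (suc t)) refl (<ᵇ→< _ _ e)
        where
        row-has-cell : ∀ n → p (suc t) ≡ n → q (suc t) < n → anyᵇ (λ y → Cell.row y ≡ᵇ suc t) cells ≡ true
        row-has-cell (suc j) ep lt = anyᵇ⁺ (λ y → Cell.row y ≡ᵇ suc t) cells (∈-skewCells⁺ t j tl lt (≤-reflexive (sym ep))) (≡→≡ᵇ (suc t) (suc t) refl)

  rowsOf≡sumBelow-rowOccupied : ∀ λ′ μ W → length λ′ ≤ W → rowsOf λ′ μ ≡ sumBelow (λ t → rowOccupied (part λ′ (suc t)) (part μ (suc t))) W
  rowsOf≡sumBelow-rowOccupied λ′ μ W le = trans (length-filt-applyUpTo _ suc (length λ′))
    (trans (sumBelow-cong< _ _ (length λ′) (λ t tl → cong count (SkewCells.anyᵇ-row≡<ᵇ λ′ μ t tl)))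
    (sumBelow-extend _ (length λ′) W le (λ t lt → cong (λ z → count (part μ (suc t) <ᵇ z)) (part-beyond λ′ t lt))))

  columnOccupiedᵇ : ℕ → (ℕ → ℕ) → (ℕ → ℕ) → ℕ → Bool
  columnOccupiedᵇ zero p q j = false
  columnOccupiedᵇ (suc ℓ) p q j = ((q 1 <ᵇ j) ∧ (j ≤ᵇ p 1)) ∨ columnOccupiedᵇ ℓ (λ i → p (suc i)) (λ i → q (suc i)) j

  columnOccupiedᵇ⁻ : ∀ ℓ p q j → columnOccupiedᵇ ℓ p q j ≡ true → ∃ λ t → (t < ℓ) × (q (suc t) < j) × (j ≤ p (suc t))
  columnOccupiedᵇ⁻ (suc ℓ) p q j e with ∨-true⁻ {(q 1 <ᵇ j) ∧ (j ≤ᵇ p 1)} e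
  ... | inj₁ e1 = 0 , s≤s z≤n , <ᵇ→< _ _ (proj₁ (∧-true⁻ e1)) , ≤ᵇ→≤ _ _ (proj₂ (∧-true⁻ {q 1 <ᵇ j} e1))
  ... | inj₂ e2 with columnOccupiedᵇ⁻ ℓ (λ i → p (suc i)) (λ i → q (suc i)) j e2
  ...   | t , tl , a , b = suc t , s≤s tl , a , b

  columnOccupiedᵇ⁺ : ∀ ℓ p q j t → t < ℓ → q (suc t) < j → j ≤ p (suc t) → columnOccupiedᵇ ℓ p q j ≡ true
  columnOccupiedᵇ⁺ (suc ℓ) p q j zero tl a b rewrite <→<ᵇ _ _ a | ≤→≤ᵇ _ _ b = refl
  columnOccupiedᵇ⁺ (suc ℓ) p q j (suc t) (s≤s tl) a b = ∨-true⁺ʳ ((q 1 <ᵇ j) ∧ (j ≤ᵇ p 1)) (columnOccupiedᵇ⁺ ℓ (λ i → p (suc i)) (λ i → q (suc i)) j t tl a b)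

  anyᵇ-col≡columnOccupiedᵇ : ∀ λ′ μ j → anyᵇ (λ y → Cell.col y ≡ᵇ j) (skewCells λ′ μ) ≡ columnOccupiedᵇ (length λ′) (part λ′) (part μ) j
  anyᵇ-col≡columnOccupiedᵇ λ′ μ j = bool-iff _ _ fw bw
    where
    open SkewCells λ′ μ
    fw : anyᵇ (λ y → Cell.col y ≡ᵇ j) cells ≡ true → columnOccupiedᵇ ℓ′ p q j ≡ true
    fw e with anyᵇ⁻ (λ y → Cell.col y ≡ᵇ j) cells e
    ... | y , m , ey with ∈-skewCells⁻ m
    ... | t , er , tl , ql , jl = subst (λ z → columnOccupiedᵇ ℓ′ p q z ≡ true) (≡ᵇ→≡ (Cell.col y) j ey) (columnOccupiedᵇ⁺ ℓ′ p q (Cell.col y) t tl ql jl)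
    bw : columnOccupiedᵇ ℓ′ p q j ≡ true → anyᵇ (λ y → Cell.col y ≡ᵇ j) cells ≡ true
    bw e with columnOccupiedᵇ⁻ ℓ′ p q j e
    ... | t , tl , ql , jl = column-has-cell j refl ql jl
      where
      column-has-cell : ∀ n → j ≡ n → q (suc t) < n → n ≤ p (suc t) → anyᵇ (λ y → Cell.col y ≡ᵇ j) cells ≡ true
      column-has-cell (suc j′) ej ql jl = anyᵇ⁺ (λ y → Cell.col y ≡ᵇ j) cells (∈-skewCells⁺ t j′ tl ql jl) (≡→≡ᵇ (suc j′) j (sym ej))

  sumBelow-count-<ᵇ : ∀ a n Q → sumBelow (λ t → count (Q <ᵇ suc (a + t))) n ≡ (a + n) ∸ (a ⊔ Q)
  sumBelow-count-<ᵇ a zero Q = sym (trans (cong (_∸ (a ⊔ Q)) (+-identityʳ a)) (m≤n⇒m∸n≡0 (m≤m⊔n a Q)))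
  sumBelow-count-<ᵇ a (suc n) Q = begin
    count (Q <ᵇ suc (a + 0)) + sumBelow (λ t → count (Q <ᵇ suc (a + suc t))) n
      ≡⟨ cong (count (Q <ᵇ suc (a + 0)) +_) (trans (sumBelow-cong _ (λ t → count (Q <ᵇ suc (suc a + t))) n (λ t → cong (λ z → count (Q <ᵇ suc z)) (+-suc a t))) (sumBelow-count-<ᵇ (suc a) n Q)) ⟩
    count (Q <ᵇ suc (a + 0)) + ((suc a + n) ∸ (suc a ⊔ Q)) ≡⟨ fin ⟩
    (a + suc n) ∸ (a ⊔ Q) ∎
    where
    open ≡-Reasoning
    fin : count (Q <ᵇ suc (a + 0)) + ((suc a + n) ∸ (suc a ⊔ Q)) ≡ (a + suc n) ∸ (a ⊔ Q)
    fin with Q ≤? a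
    ... | yes Q≤a rewrite +-identityʳ a | <→<ᵇ Q (suc a) (s≤s Q≤a) | m≥n⇒m⊔n≡m Q≤a | m≥n⇒m⊔n≡m (m≤n⇒m≤1+n Q≤a)
        = sym (trans (m+n∸m≡n a (suc n)) (cong suc (sym (m+n∸m≡n (suc a) n))))
    ... | no Q≰a rewrite +-identityʳ a | m≤n⇒m⊔n≡n (≰⇒> Q≰a) | m≤n⇒m⊔n≡n (<⇒≤ (≰⇒> Q≰a)) | +-suc a n
        = cong (λ z → count z + (suc (a + n) ∸ Q)) (¬-not (λ e → <⇒≱ (≰⇒> Q≰a) (s≤s⁻¹ (<ᵇ→< _ _ e))))

  part≤part₁ : ∀ (p : ℕ → ℕ) → (∀ t → p (suc (suc t)) ≤ p (suc t)) → ∀ t → p (suc t) ≤ p 1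
  part≤part₁ p pd zero = ≤-refl
  part≤part₁ p pd (suc t) = ≤-trans (pd t) (part≤part₁ p pd t)

  columnOccupiedᵇ-below : ∀ ℓ (p′ q′ : ℕ → ℕ) t → p′ (suc ℓ) ≡ 0 → t < p′ 1 → q′ 1 < suc t → columnOccupiedᵇ ℓ p′ q′ (suc t) ≡ true
  columnOccupiedᵇ-below zero p′ q′ t z tl ql = ⊥-elim (<⇒≱ tl (≤-trans (≤-reflexive z) z≤n))
  columnOccupiedᵇ-below (suc ℓ) p′ q′ t z tl ql = columnOccupiedᵇ⁺ (suc ℓ) p′ q′ (suc t) 0 (s≤s z≤n) ql tl

  module _ (ℓ : ℕ) (p q : ℕ → ℕ) (p-dec : ∀ t → p (suc (suc t)) ≤ p (suc t)) (q-dec : ∀ t → q (suc (suc t)) ≤ q (suc t))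
           (p-end : p (suc (suc ℓ)) ≡ 0) where
    private
      p′ q′ : ℕ → ℕ
      p′ i = p (suc i)
      q′ i = q (suc i)
      inFirstRow : ℕ → Bool
      inFirstRow j = (q 1 <ᵇ j) ∧ (j ≤ᵇ p 1)

    columnOccupiedᵇ-low : ∀ t → t < p 2 → count (columnOccupiedᵇ (suc ℓ) p q (suc t)) ≡ count (columnOccupiedᵇ ℓ p′ q′ (suc t))
    columnOccupiedᵇ-low t t<p₂ with columnOccupiedᵇ ℓ p′ q′ (suc t) in eq
    ... | true = cong count (∨-true⁺ʳ (inFirstRow (suc t)) refl)
    ... | false = cong count (trans (∨-identityʳ (inFirstRow (suc t))) (¬-not occupied-below))
      where
      occupied-below : inFirstRow (suc t) ≡ true → ⊥
      occupied-below e with () ← trans (sym eq) (columnOccupiedᵇ-below ℓ p′ q′ t p-end t<p₂ (≤-<-trans (q-dec 0) (<ᵇ→< _ _ (proj₁ (∧-true⁻ e)))))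

    columnOccupiedᵇ-high : ∀ t → t < p 1 ∸ p 2 → count (columnOccupiedᵇ (suc ℓ) p q (suc (p 2 + t))) ≡ count (q 1 <ᵇ suc (p 2 + t))
    columnOccupiedᵇ-high t t< with columnOccupiedᵇ ℓ p′ q′ (suc (p 2 + t)) in eq
    ... | true with columnOccupiedᵇ⁻ ℓ p′ q′ _ eq
    ...   | t′ , _ , _ , le = ⊥-elim (<⇒≱ (s≤s (m≤m+n (p 2) t)) (≤-trans le (part≤part₁ p′ (λ s → p-dec (suc s)) t′)))
    columnOccupiedᵇ-high t t< | false =
      cong count (trans (∨-identityʳ (inFirstRow (suc (p 2 + t)))) (trans (cong ((q 1 <ᵇ suc (p 2 + t)) ∧_) (≤→≤ᵇ _ _ below-p₁)) (∧-identityʳ _)))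
      where
      below-p₁ : suc (p 2 + t) ≤ p 1
      below-p₁ = subst (suc (p 2 + t) ≤_) (m+[n∸m]≡n (p-dec 0)) (+-monoʳ-< (p 2) t<)

  -- Split the columns 1 … λ_1 at λ_2: the lower ones are counted by the rows below the first,
  -- the upper ones meet only the first row and are occupied exactly right of μ_1.
  sumBelow-columnOccupied : ∀ ℓ (p q : ℕ → ℕ) → (∀ t → p (suc (suc t)) ≤ p (suc t)) → (∀ t → q (suc (suc t)) ≤ q (suc t)) →
    (∀ t → q (suc t) ≤ p (suc t)) → p (suc ℓ) ≡ 0 →
    sumBelow (λ t → count (columnOccupiedᵇ ℓ p q (suc t))) (p 1) ≡ sumBelow (λ t → newColumns (p (suc t)) (q (suc t)) (p (suc (suc t)))) ℓ
  sumBelow-columnOccupied zero p q pd qd qp z = cong (sumBelow (λ t → count (columnOccupiedᵇ zero p q (suc t)))) z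
  sumBelow-columnOccupied (suc ℓ) p q pd qd qp z = begin
    sumBelow G (p 1)                                              ≡⟨ cong (sumBelow G) (sym (m+[n∸m]≡n (pd 0))) ⟩
    sumBelow G (p 2 + (p 1 ∸ p 2))                                ≡⟨ sumBelow-split G (p 2) (p 1 ∸ p 2) ⟩
    sumBelow G (p 2) + sumBelow (λ t → G (p 2 + t)) (p 1 ∸ p 2)   ≡⟨ cong₂ _+_ low high ⟩
    sumBelow N′ ℓ + newColumns (p 1) (q 1) (p 2)                  ≡⟨ +-comm (sumBelow N′ ℓ) _ ⟩
    newColumns (p 1) (q 1) (p 2) + sumBelow N′ ℓ                  ∎
    where
    open ≡-Reasoning
    G N′ : ℕ → ℕ
    G t = count (columnOccupiedᵇ (suc ℓ) p q (suc t))
    N′ t = newColumns (p (suc (suc t))) (q (suc (suc t))) (p (suc (suc (suc t))))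
    low : sumBelow G (p 2) ≡ sumBelow N′ ℓ
    low = trans (sumBelow-cong< _ _ (p 2) (columnOccupiedᵇ-low ℓ p q pd qd z))
                (sumBelow-columnOccupied ℓ (λ i → p (suc i)) (λ i → q (suc i)) (λ t → pd (suc t)) (λ t → qd (suc t)) (λ t → qp (suc t)) z)
    high : sumBelow (λ t → G (p 2 + t)) (p 1 ∸ p 2) ≡ newColumns (p 1) (q 1) (p 2)
    high = trans (sumBelow-cong< _ _ (p 1 ∸ p 2) (columnOccupiedᵇ-high ℓ p q pd qd z))
                 (trans (sumBelow-count-<ᵇ (p 2) (p 1 ∸ p 2) (q 1)) (cong (_∸ (p 2 ⊔ q 1)) (m+[n∸m]≡n (pd 0))))

  colsOf≡sumBelow-newColumns : ∀ λ′ μ W → Decreasing λ′ → Decreasing μ → (∀ j → part μ j ≤ part λ′ j) → length λ′ ≤ W →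
    colsOf λ′ μ ≡ sumBelow (λ t → newColumns (part λ′ (suc t)) (part μ (suc t)) (part λ′ (suc (suc t)))) W
  colsOf≡sumBelow-newColumns λ′ μ W dλ dm qp le = trans (length-filt-applyUpTo _ suc (part λ′ 1))
    (trans (sumBelow-cong _ _ (part λ′ 1) (λ t → cong count (anyᵇ-col≡columnOccupiedᵇ λ′ μ (suc t))))
    (trans (sumBelow-columnOccupied (length λ′) (part λ′) (part μ) (part-dec λ′ dλ) (part-dec μ dm) (λ t → qp (suc t)) (part-beyond λ′ (length λ′) ≤-refl))
    (sumBelow-extend _ (length λ′) W le (λ t lt → trans (cong (λ z → z ∸ (part λ′ (suc (suc t)) ⊔ part μ (suc t))) (part-beyond λ′ t lt)) (0∸n≡0 (part λ′ (suc (suc t)) ⊔ part μ (suc t)))))))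


module ComponentCount where

  open import Defs
  open NatBool
  open LocalExponents using (count; componentStart)
  open PartitionLists using (anyᵇ⁺; anyᵇ⁻)
  open NatSums
  open import Data.Bool using (Bool; true; false; if_then_else_; _∧_; _∨_; not)
  open import Data.Bool.Properties using (¬-not; ∧-zeroʳ)
  open import Data.Nat using (ℕ; zero; suc; _+_; _≤_; _<_; _≤ᵇ_; _<ᵇ_; _≡ᵇ_; z≤n; s≤s; s≤s⁻¹)
  open import Data.Nat.Properties
  open import Data.List using (List; []; _∷_; map; concatMap; upTo; length; foldr; _++_)
  open import Data.List.Relation.Unary.All as All using (All; []; _∷_)
  open import Data.List.Relation.Unary.Any as Any using (here; there)
  open import Data.List.Membership.Propositional using (_∈_)
  open import Data.List.Membership.Propositional.Properties using (∈-++⁻; ∈-++⁺ˡ; ∈-++⁺ʳ)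
  open import Data.Product using (_×_; _,_; proj₁; proj₂)
  open import Data.Sum using (_⊎_; inj₁; inj₂)
  open import Data.Empty using (⊥; ⊥-elim)
  open import Relation.Nullary using (¬_; yes; no)
  open import Relation.Binary.PropositionalEquality

  distℕ≡0⇒≡ : ∀ a b → distℕ a b ≡ 0 → a ≡ b
  distℕ≡0⇒≡ zero zero e = refl
  distℕ≡0⇒≡ (suc a) (suc b) e = cong suc (distℕ≡0⇒≡ a b e)

  distℕ≡1⇒ : ∀ a b → distℕ a b ≡ 1 → (a ≡ suc b) ⊎ (b ≡ suc a)
  distℕ≡1⇒ zero (suc zero) e = inj₂ refl
  distℕ≡1⇒ (suc zero) zero e = inj₁ refl
  distℕ≡1⇒ (suc a) (suc b) e with distℕ≡1⇒ a b e
  ... | inj₁ x = inj₁ (cong suc x)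
  ... | inj₂ y = inj₂ (cong suc y)
  distℕ≡1⇒ zero (suc (suc b)) ()
  distℕ≡1⇒ (suc (suc a)) zero ()

  distℕ-refl : ∀ a → distℕ a a ≡ 0
  distℕ-refl zero = refl
  distℕ-refl (suc a) = distℕ-refl a

  distℕ-suc : ∀ a → distℕ a (suc a) ≡ 1
  distℕ-suc zero = refl
  distℕ-suc (suc a) = distℕ-suc a

  Adjacent : Cell → Cell → Set
  Adjacent (cell i j) (cell i′ j′) = ((i′ ≡ i) × ((j′ ≡ suc j) ⊎ (j ≡ suc j′))) ⊎ ((j′ ≡ j) × ((i′ ≡ suc i) ⊎ (i ≡ suc i′)))

  +≡1⇒ : ∀ a b → a + b ≡ 1 → ((a ≡ 0) × (b ≡ 1)) ⊎ ((a ≡ 1) × (b ≡ 0))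
  +≡1⇒ zero b e = inj₁ (refl , e)
  +≡1⇒ (suc zero) zero e = inj₂ (refl , refl)
  +≡1⇒ (suc zero) (suc b) ()
  +≡1⇒ (suc (suc a)) b ()

  adjacentᵇ⇒Adjacent : ∀ x y → adjacentᵇ x y ≡ true → Adjacent x y
  adjacentᵇ⇒Adjacent (cell i j) (cell i′ j′) e with +≡1⇒ (distℕ i i′) (distℕ j j′) (≡ᵇ→≡ _ 1 e)
  ... | inj₁ (d0 , d1) = inj₁ (sym (distℕ≡0⇒≡ i i′ d0) , Data.Sum.swap (distℕ≡1⇒ j j′ d1))
  ... | inj₂ (d1 , d0) = inj₂ (sym (distℕ≡0⇒≡ j j′ d0) , Data.Sum.swap (distℕ≡1⇒ i i′ d1))

  adjacentᵇ-right : ∀ i j → adjacentᵇ (cell i j) (cell i (suc j)) ≡ true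
  adjacentᵇ-right i j rewrite distℕ-refl i | distℕ-suc j = refl

  adjacentᵇ-down : ∀ i j → adjacentᵇ (cell i j) (cell (suc i) j) ≡ true
  adjacentᵇ-down i j rewrite distℕ-refl j | distℕ-suc i | +-identityʳ 1 = refl

  adjacentᵇ-row≤ : ∀ i j y → adjacentᵇ (cell i j) y ≡ true → Cell.row y ≤ suc i
  adjacentᵇ-row≤ i j (cell i′ j′) e with adjacentᵇ⇒Adjacent (cell i j) (cell i′ j′) e
  ... | inj₁ (refl , _) = n≤1+n i
  ... | inj₂ (_ , inj₁ refl) = ≤-refl
  ... | inj₂ (_ , inj₂ refl) = ≤-trans (n≤1+n i′) (n≤1+n (suc i′))

  touches : Cell → List Cell → Bool
  touches x c = anyᵇ (adjacentᵇ x) c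

  -- Only rows ≤ i + 1 are described: cells further down cannot touch a cell of row i.
  Describes : ℕ → List Cell → (Cell → Set) → Set
  Describes i c D = ∀ y → Cell.row y ≤ suc i → ((y ∈ c) → D y) × (D y → (y ∈ c))

  Nowhere : Cell → Set
  Nowhere _ = ⊥

  touches-false : ∀ i j c D → Describes i c D → (∀ y → adjacentᵇ (cell i j) y ≡ true → D y → ⊥) → touches (cell i j) c ≡ false
  touches-false i j c D d h = ¬-not λ e → let (y , m , ey) = anyᵇ⁻ (adjacentᵇ (cell i j)) c e in h y ey (proj₁ (d y (adjacentᵇ-row≤ i j y ey)) m)

  touches-true : ∀ i j c D y → Describes i c D → adjacentᵇ (cell i j) y ≡ true → D y → touches (cell i j) c ≡ true
  touches-true i j c D y d ey Dy = anyᵇ⁺ (adjacentᵇ (cell i j)) c (proj₂ (d y (adjacentᵇ-row≤ i j y ey)) Dy) ey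

  filt-untouched : ∀ x cs → All (λ c → touches x c ≡ false) cs →
    (filt (touches x) cs ≡ []) × (filt (λ k → not (touches x k)) cs ≡ cs)
  filt-untouched x [] [] = refl , refl
  filt-untouched x (c ∷ cs) (e ∷ es) rewrite e = proj₁ (filt-untouched x cs es) , cong (c ∷_) (proj₂ (filt-untouched x cs es))

  insertCell-new : ∀ x cs → All (λ c → touches x c ≡ false) cs → insertCell x cs ≡ (x ∷ []) ∷ cs
  insertCell-new x cs es rewrite proj₁ (filt-untouched x cs es) | proj₂ (filt-untouched x cs es) = refl

  insertCell-join : ∀ x c cs → touches x c ≡ true → All (λ c → touches x c ≡ false) cs → insertCell x (c ∷ cs) ≡ (x ∷ (c ++ [])) ∷ cs
  insertCell-join x c cs e es rewrite e | proj₁ (filt-untouched x cs es) | proj₂ (filt-untouched x cs es) = refl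

  insertCell-merge : ∀ x c1 c2 cs → touches x c1 ≡ true → touches x c2 ≡ true → All (λ c → touches x c ≡ false) cs →
    insertCell x (c1 ∷ c2 ∷ cs) ≡ (x ∷ (c1 ++ (c2 ++ []))) ∷ cs
  insertCell-merge x c1 c2 cs e1 e2 es rewrite e1 | e2 | proj₁ (filt-untouched x cs es) | proj₂ (filt-untouched x cs es) = refl

  SameUpTo : ℕ → (Cell → Set) → (Cell → Set) → Set
  SameUpTo i D D′ = ∀ y → Cell.row y ≤ suc i → (D y → D′ y) × (D′ y → D y)

  Describes-cong : ∀ {i c D D′} → Describes i c D → SameUpTo i D D′ → Describes i c D′
  Describes-cong d e y r = (λ m → proj₁ (e y r) (proj₁ (d y r) m)) , (λ D′y → proj₂ (d y r) (proj₂ (e y r) D′y))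

  Describes-lower : ∀ {k i c D D′} → k ≤ i → Describes i c D → SameUpTo k D D′ → Describes k c D′
  Describes-lower {k} {i} le d e y r = (λ m → proj₁ (e y r) (proj₁ (d y r′) m)) , (λ D′y → proj₂ (d y r′) (proj₂ (e y r) D′y))
    where r′ = ≤-trans r (s≤s le)

  Describes-single : ∀ i x → Describes i (x ∷ []) (λ y → y ≡ x)
  Describes-single i x y r = (λ { (here e) → e }) , (λ e → here e)

  Describes-∷ : ∀ {i c D} x → Describes i c D → Describes i (x ∷ (c ++ [])) (λ y → (y ≡ x) ⊎ D y)
  Describes-∷ {i} {c} x d y r = fw , bw
    where
    fw : y ∈ x ∷ (c ++ []) → _
    fw (here e) = inj₁ e
    fw (there m) with ∈-++⁻ c m
    ... | inj₁ m′ = inj₂ (proj₁ (d y r) m′)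
    ... | inj₂ ()
    bw : _ → y ∈ x ∷ (c ++ [])
    bw (inj₁ e) = here e
    bw (inj₂ Dy) = there (∈-++⁺ˡ (proj₂ (d y r) Dy))

  Describes-merge : ∀ {i c1 c2 D1 D2} x → Describes i c1 D1 → Describes i c2 D2 → Describes i (x ∷ (c1 ++ (c2 ++ []))) (λ y → (y ≡ x) ⊎ (D1 y ⊎ D2 y))
  Describes-merge {i} {c1} {c2} x d1 d2 y r = fw , bw
    where
    fw : y ∈ x ∷ (c1 ++ (c2 ++ [])) → _
    fw (here e) = inj₁ e
    fw (there m) with ∈-++⁻ c1 m
    ... | inj₁ m′ = inj₂ (inj₁ (proj₁ (d1 y r) m′))
    ... | inj₂ m2 with ∈-++⁻ c2 m2
    ...   | inj₁ m′ = inj₂ (inj₂ (proj₁ (d2 y r) m′))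
    ...   | inj₂ ()
    bw : _ → y ∈ x ∷ (c1 ++ (c2 ++ []))
    bw (inj₁ e) = here e
    bw (inj₂ (inj₁ D)) = there (∈-++⁺ˡ (proj₂ (d1 y r) D))
    bw (inj₂ (inj₂ D)) = there (∈-++⁺ʳ c1 (∈-++⁺ˡ (proj₂ (d2 y r) D)))

  -- components inserts the cells of λ/μ bottom row first and right to left within a row. Before
  -- row i is inserted, at most one component meets row i + 1 (Frontier); while it is inserted,
  -- the cells of row i right of column j form a segment which is either still separate or merged
  -- with that component (RowState). So row i adds a component iff it is nonempty and λ_{i+1} ≤ μ_i.
  module ByRows (p q : ℕ → ℕ) where

    RowBelow : ℕ → Cell → Set
    RowBelow i y = (Cell.row y ≡ suc i) × (q (suc i) < Cell.col y) × (Cell.col y ≤ p (suc i))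

    Segment : ℕ → ℕ → Cell → Set
    Segment i j y = (Cell.row y ≡ i) × (j < Cell.col y) × (Cell.col y ≤ p i)

    SegmentAndBelow : ℕ → ℕ → Cell → Set
    SegmentAndBelow i j y = Segment i j y ⊎ RowBelow i y

    AllNowhere : ℕ → List (List Cell) → Set
    AllNowhere i = All (λ d → Describes i d Nowhere)

    data Frontier (i : ℕ) : List (List Cell) → Set where
      frontier : ∀ {c ds} → Describes i c (RowBelow i) → AllNowhere i ds → Frontier i (c ∷ ds)
      emptyFrontier : ∀ {ds} → p (suc i) ≤ q (suc i) → AllNowhere i ds → Frontier i ds

    data RowState (i j N : ℕ) : List (List Cell) → Set where
      fresh : ∀ {cs} → j ≡ p i → Frontier i cs → length cs ≡ N → RowState i j N cs
      segment : ∀ {t rest} → j < p i → p (suc i) ≤ j → Describes i t (Segment i j) → Frontier i rest → length rest ≡ N → RowState i j N (t ∷ rest)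
      merged : ∀ {m ds} → j < p (suc i) → Describes i m (SegmentAndBelow i j) → AllNowhere i ds → suc (length ds) ≡ N → RowState i j N (m ∷ ds)

    touches-Nowhere : ∀ i j c → Describes i c Nowhere → touches (cell i j) c ≡ false
    touches-Nowhere i j c d = touches-false i j c Nowhere d (λ y _ ())

    touches-AllNowhere : ∀ i j ds → AllNowhere i ds → All (λ c → touches (cell i j) c ≡ false) ds
    touches-AllNowhere i j [] [] = []
    touches-AllNowhere i j (d ∷ ds) (x ∷ xs) = touches-Nowhere i j d x ∷ touches-AllNowhere i j ds xs

    touches-RowBelow-false : ∀ i j c → Describes i c (RowBelow i) → p (suc i) < j → touches (cell i j) c ≡ false
    touches-RowBelow-false i j c d lt = touches-false i j c (RowBelow i) d h
      where
      h : ∀ y → adjacentᵇ (cell i j) y ≡ true → RowBelow i y → ⊥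
      h (cell i′ j′) e (r , ql , cl) with adjacentᵇ⇒Adjacent (cell i j) (cell i′ j′) e
      ... | inj₁ (ri , _) = 1+n≢n (trans (sym r) ri)
      ... | inj₂ (refl , _) = <⇒≱ lt cl

    touches-RowBelow : ∀ i j c → Describes i c (RowBelow i) → q (suc i) < j → j ≤ p (suc i) → touches (cell i j) c ≡ true
    touches-RowBelow i j c d ql le = touches-true i j c (RowBelow i) (cell (suc i) j) d (adjacentᵇ-down i j) (refl , ql , le)

    touches-Segment : ∀ i j t → Describes i t (Segment i j) → j < p i → touches (cell i j) t ≡ true
    touches-Segment i j t d lt = touches-true i j t (Segment i j) (cell i (suc j)) d (adjacentᵇ-right i j) (refl , ≤-refl , lt)

    touches-SegmentAndBelow : ∀ i j m → Describes i m (SegmentAndBelow i j) → q (suc i) < j → j ≤ p (suc i) → touches (cell i j) m ≡ true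
    touches-SegmentAndBelow i j m d ql le = touches-true i j m (SegmentAndBelow i j) (cell (suc i) j) d (adjacentᵇ-down i j) (inj₂ (refl , ql , le))

    Frontier-untouched : ∀ i j cs → Frontier i cs → p (suc i) < j → All (λ c → touches (cell i j) c ≡ false) cs
    Frontier-untouched i j (c ∷ ds) (frontier dc dd) lt = touches-RowBelow-false i j c dc lt ∷ touches-AllNowhere i j ds dd
    Frontier-untouched i j cs (emptyFrontier h dd) lt = touches-AllNowhere i j cs dd

    segment-extend : ∀ i n → suc n ≤ p i → SameUpTo i (λ y → (y ≡ cell i (suc n)) ⊎ Segment i (suc n) y) (Segment i n)
    segment-extend i n le y r = fw , bw
      where
      fw : (y ≡ cell i (suc n)) ⊎ Segment i (suc n) y → Segment i n y
      fw (inj₁ refl) = refl , ≤-refl , le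
      fw (inj₂ (a , b , c)) = a , <-trans (n<1+n n) b , c
      bw : Segment i n y → (y ≡ cell i (suc n)) ⊎ Segment i (suc n) y
      bw (a , b , c) with m≤n⇒m<n∨m≡n b
      ... | inj₁ lt = inj₂ (a , lt , c)
      ... | inj₂ e = inj₁ (cong₂ cell a (sym e))

    segment-single : ∀ i n → p i ≡ suc n → SameUpTo i (λ y → y ≡ cell i (suc n)) (Segment i n)
    segment-single i n e y r = (λ h → proj₁ (segment-extend i n (≤-reflexive (sym e)) y r) (inj₁ h)) , bw
      where
      bw : Segment i n y → y ≡ cell i (suc n)
      bw t with proj₂ (segment-extend i n (≤-reflexive (sym e)) y r) t
      ... | inj₁ h = h
      ... | inj₂ (_ , lt , c) = ⊥-elim (<⇒≱ lt (≤-trans c (≤-reflexive e)))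

    merged-single : ∀ i n → p i ≡ suc n → SameUpTo i (λ y → (y ≡ cell i (suc n)) ⊎ RowBelow i y) (SegmentAndBelow i n)
    merged-single i n e y r = fw , bw
      where
      fw : (y ≡ cell i (suc n)) ⊎ RowBelow i y → SegmentAndBelow i n y
      fw (inj₁ h) = inj₁ (proj₁ (segment-single i n e y r) h)
      fw (inj₂ b) = inj₂ b
      bw : SegmentAndBelow i n y → (y ≡ cell i (suc n)) ⊎ RowBelow i y
      bw (inj₁ t) = inj₁ (proj₂ (segment-single i n e y r) t)
      bw (inj₂ b) = inj₂ b

    merged-join : ∀ i n → suc n ≤ p i → SameUpTo i (λ y → (y ≡ cell i (suc n)) ⊎ (Segment i (suc n) y ⊎ RowBelow i y)) (SegmentAndBelow i n)
    merged-join i n le y r = fw , bw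
      where
      fw : (y ≡ cell i (suc n)) ⊎ (Segment i (suc n) y ⊎ RowBelow i y) → SegmentAndBelow i n y
      fw (inj₁ h) = inj₁ (proj₁ (segment-extend i n le y r) (inj₁ h))
      fw (inj₂ (inj₁ t)) = inj₁ (proj₁ (segment-extend i n le y r) (inj₂ t))
      fw (inj₂ (inj₂ b)) = inj₂ b
      bw : SegmentAndBelow i n y → (y ≡ cell i (suc n)) ⊎ (Segment i (suc n) y ⊎ RowBelow i y)
      bw (inj₁ t) with proj₂ (segment-extend i n le y r) t
      ... | inj₁ h = inj₁ h
      ... | inj₂ t′ = inj₂ (inj₁ t′)
      bw (inj₂ b) = inj₂ (inj₂ b)

    merged-extend : ∀ i n → suc n ≤ p i → SameUpTo i (λ y → (y ≡ cell i (suc n)) ⊎ SegmentAndBelow i (suc n) y) (SegmentAndBelow i n)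
    merged-extend i n le y r = fw , bw
      where
      fw : (y ≡ cell i (suc n)) ⊎ SegmentAndBelow i (suc n) y → SegmentAndBelow i n y
      fw (inj₁ h) = inj₁ (proj₁ (segment-extend i n le y r) (inj₁ h))
      fw (inj₂ (inj₁ t)) = inj₁ (proj₁ (segment-extend i n le y r) (inj₂ t))
      fw (inj₂ (inj₂ b)) = inj₂ b
      bw : SegmentAndBelow i n y → (y ≡ cell i (suc n)) ⊎ SegmentAndBelow i (suc n) y
      bw (inj₁ t) with proj₂ (segment-extend i n le y r) t
      ... | inj₁ h = inj₁ h
      ... | inj₂ t′ = inj₂ (inj₁ t′)
      bw (inj₂ b) = inj₂ (inj₂ b)

    insert-step : ∀ i n N cs → q (suc i) ≤ q i → p (suc i) ≤ p i → q i ≤ n →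
      RowState i (suc n) N cs → RowState i n N (insertCell (cell i (suc n)) cs)
    insert-step i n N cs qsi psi qin (fresh e f1 len) with suc n ≤? p (suc i)
    insert-step i n N (c ∷ ds) qsi psi qin (fresh e (frontier dc dd) len) | yes le =
      subst (RowState i n N) (sym (insertCell-join (cell i (suc n)) c ds (touches-RowBelow i (suc n) c dc ql le) (touches-AllNowhere i (suc n) ds dd)))
        (merged le (Describes-cong (Describes-∷ (cell i (suc n)) dc) (merged-single i n (sym e))) dd len)
      where ql = s≤s (≤-trans qsi qin)
    insert-step i n N cs qsi psi qin (fresh e (emptyFrontier h dd) len) | yes le = ⊥-elim (<⇒≱ (<-≤-trans (s≤s (≤-trans qsi qin)) le) h)
    ... | no nle = subst (RowState i n N) (sym (insertCell-new (cell i (suc n)) cs (Frontier-untouched i (suc n) cs f1 lt)))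
        (segment (≤-reflexive e) (s≤s⁻¹ lt) (Describes-cong (Describes-single i (cell i (suc n))) (segment-single i n (sym e))) f1 len)
      where lt = ≰⇒> nle
    insert-step i n N (t ∷ rest) qsi psi qin (segment lt ple dt f1 len) with suc n ≤? p (suc i)
    insert-step i n N (t ∷ (c ∷ ds)) qsi psi qin (segment lt ple dt (frontier dc dd) len) | yes le =
      subst (RowState i n N) (sym (insertCell-merge (cell i (suc n)) t c ds (touches-Segment i (suc n) t dt lt) (touches-RowBelow i (suc n) c dc ql le) (touches-AllNowhere i (suc n) ds dd)))
        (merged le (Describes-cong (Describes-merge (cell i (suc n)) dt dc) (merged-join i n (<⇒≤ lt))) dd len)
      where ql = s≤s (≤-trans qsi qin)
    insert-step i n N (t ∷ rest) qsi psi qin (segment lt ple dt (emptyFrontier h dd) len) | yes le = ⊥-elim (<⇒≱ (<-≤-trans (s≤s (≤-trans qsi qin)) le) h)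
    ... | no nle = subst (RowState i n N) (sym (insertCell-join (cell i (suc n)) t rest (touches-Segment i (suc n) t dt lt) (Frontier-untouched i (suc n) rest f1 lt′)))
        (segment (<-trans (n<1+n n) lt) (s≤s⁻¹ lt′) (Describes-cong (Describes-∷ (cell i (suc n)) dt) (segment-extend i n (<⇒≤ lt))) f1 len)
      where lt′ = ≰⇒> nle
    insert-step i n N (m ∷ ds) qsi psi qin (merged lt dm dd len) =
      subst (RowState i n N) (sym (insertCell-join (cell i (suc n)) m ds (touches-SegmentAndBelow i (suc n) m dm ql (<⇒≤ lt)) (touches-AllNowhere i (suc n) ds dd)))
        (merged (<-trans (n<1+n n) lt) (Describes-cong (Describes-∷ (cell i (suc n)) dm) (merged-extend i n (≤-trans (<⇒≤ lt) psi))) dd len)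
      where ql = s≤s (≤-trans qsi qin)

    rowCells : ℕ → ℕ → List Cell
    rowCells i n = map (λ j → cell i (suc j)) (filt (λ j → q i <ᵇ suc j) (upTo n))

    filt-++ : ∀ {X : Set} (P : X → Bool) xs ys → filt P (xs ++ ys) ≡ filt P xs ++ filt P ys
    filt-++ P [] ys = refl
    filt-++ P (x ∷ xs) ys with P x
    ... | true = cong (x ∷_) (filt-++ P xs ys)
    ... | false = filt-++ P xs ys

    rowCells-empty : ∀ Q n → n ≤ Q → filt (λ j → Q <ᵇ suc j) (upTo n) ≡ []
    rowCells-empty Q zero _ = refl
    rowCells-empty Q (suc n) le = begin≡
      filt P (upTo (suc n)) ≡⟨ cong (filt P) (sym (Data.List.Properties.upTo-∷ʳ n)) ⟩
      filt P (upTo n ++ (n ∷ [])) ≡⟨ filt-++ P (upTo n) (n ∷ []) ⟩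
      filt P (upTo n) ++ filt P (n ∷ []) ≡⟨ cong₂ _++_ (rowCells-empty Q n (≤-trans (n≤1+n n) le)) (lastF (¬-not (λ e → <⇒≱ (<ᵇ→< Q (suc n) e) le))) ⟩
      [] ∎≡
      where
      import Data.List.Properties
      open ≡-Reasoning renaming (begin_ to begin≡_; _∎ to _∎≡)
      P = λ j → Q <ᵇ suc j
      lastF : P n ≡ false → filt P (n ∷ []) ≡ []
      lastF e rewrite e = refl

    rowCells-snoc : ∀ Q n → Q ≤ n → filt (λ j → Q <ᵇ suc j) (upTo (suc n)) ≡ filt (λ j → Q <ᵇ suc j) (upTo n) ++ (n ∷ [])
    rowCells-snoc Q n le = trans (cong (filt P) (sym (Data.List.Properties.upTo-∷ʳ n)))
        (trans (filt-++ P (upTo n) (n ∷ [])) (cong (filt P (upTo n) ++_) (lastT (<→<ᵇ Q (suc n) (s≤s le)))))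
      where
      import Data.List.Properties
      P = λ j → Q <ᵇ suc j
      lastT : P n ≡ true → filt P (n ∷ []) ≡ n ∷ []
      lastT e rewrite e = refl

    insert-row : ∀ i n N cs → q (suc i) ≤ q i → p (suc i) ≤ p i → q i ≤ n → RowState i n N cs → RowState i (q i) N (foldr insertCell cs (rowCells i n))
    insert-row i zero N cs qsi psi qin st = subst (λ z → RowState i z N cs) (sym (n≤0⇒n≡0 qin)) st
    insert-row i (suc n) N cs qsi psi qin st with m≤n⇒m<n∨m≡n qin
    ... | inj₂ e = subst (λ z → RowState i (q i) N (foldr insertCell cs (map (λ j → cell i (suc j)) z))) (sym (rowCells-empty (q i) (suc n) (≤-reflexive (sym e))))
                     (subst (λ z → RowState i z N cs) (sym e) st)
    ... | inj₁ lt = subst (λ z → RowState i (q i) N z) (sym eq) (insert-row i n N _ qsi psi (s≤s⁻¹ lt) (insert-step i n N cs qsi psi (s≤s⁻¹ lt) st))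
      where
      import Data.List.Properties as LP
      eq : foldr insertCell cs (rowCells i (suc n)) ≡ foldr insertCell (insertCell (cell i (suc n)) cs) (rowCells i n)
      eq = trans (cong (λ z → foldr insertCell cs (map (λ j → cell i (suc j)) z)) (rowCells-snoc (q i) n (s≤s⁻¹ lt)))
             (trans (cong (foldr insertCell cs) (LP.map-++ (λ j → cell i (suc j)) (filt (λ j → q i <ᵇ suc j) (upTo n)) (n ∷ [])))
               (LP.foldr-++ insertCell cs (rowCells i n) (cell i (suc n) ∷ [])))

    AllNowhere-lower : ∀ k ds → AllNowhere (suc k) ds → AllNowhere k ds
    AllNowhere-lower k [] [] = []
    AllNowhere-lower k (d ∷ ds) (x ∷ xs) = Describes-lower (n≤1+n k) x (λ y r → (λ ()) , (λ ())) ∷ AllNowhere-lower k ds xs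

    RowBelow-lower : ∀ k c → Describes (suc k) c (RowBelow (suc k)) → Describes k c Nowhere
    RowBelow-lower k c d = Describes-lower (n≤1+n k) d (λ y r → (λ { (e , _) → 1+n≰n (≤-trans (≤-reflexive (sym e)) r) }) , (λ ()))

    Frontier-lower : ∀ k cs → Frontier (suc k) cs → AllNowhere k cs
    Frontier-lower k (c ∷ ds) (frontier dc dd) = RowBelow-lower k c dc ∷ AllNowhere-lower k ds dd
    Frontier-lower k cs (emptyFrontier _ dd) = AllNowhere-lower k cs dd

    row-end : ∀ k N cs → RowState (suc k) (q (suc k)) N cs →
      Frontier k cs × (length cs ≡ N + componentStart (p (suc k)) (q (suc k)) (p (suc (suc k))))
    row-end k N cs (fresh e f1 len) = f1′ f1 , trans len (sym (trans (cong (λ z → N + count (z ∧ (p (suc (suc k)) ≤ᵇ q (suc k)))) (trans (cong (q (suc k) <ᵇ_) (sym e)) (<ᵇ-irrefl (q (suc k))))) (+-identityʳ N)))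
      where
      f1′ : Frontier (suc k) cs → Frontier k cs
      f1′ (frontier dc dd) = emptyFrontier (≤-reflexive (sym e)) (RowBelow-lower k _ dc ∷ AllNowhere-lower k _ dd)
      f1′ (emptyFrontier h dd) = emptyFrontier (≤-reflexive (sym e)) (AllNowhere-lower k _ dd)
    row-end k N (t ∷ rest) (segment lt ple dt f1 len) =
      frontier (Describes-lower (n≤1+n k) dt (λ y r → (λ h → h) , (λ h → h))) (Frontier-lower k rest f1) ,
      trans (cong suc len) (trans (+-comm 1 N) (cong (N +_) (sym (cong count (∧-true⁺ (<→<ᵇ _ _ lt) (≤→≤ᵇ _ _ ple))))))
    row-end k N (m ∷ ds) (merged lt dm dd len) =
      frontier (Describes-lower (n≤1+n k) dm (λ y r → fw y r , inj₁)) (AllNowhere-lower k ds dd) ,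
      trans len (sym (trans (cong (λ z → N + count ((q (suc k) <ᵇ p (suc k)) ∧ z)) (¬-not (λ e → <⇒≱ lt (≤ᵇ→≤ _ _ e)))) (trans (cong (λ z → N + count z) (∧-zeroʳ (q (suc k) <ᵇ p (suc k)))) (+-identityʳ N))))
      where
      fw : ∀ y → Cell.row y ≤ suc k → SegmentAndBelow (suc k) (q (suc k)) y → RowBelow k y
      fw y r (inj₁ t) = t
      fw y r (inj₂ (e , _)) = ⊥-elim (1+n≰n (≤-trans (≤-reflexive (sym e)) r))

    rowCellsAt : ℕ → List Cell
    rowCellsAt t = rowCells (suc t) (p (suc t))

    componentStartAt : ℕ → ℕ
    componentStartAt t = componentStart (p (suc t)) (q (suc t)) (p (suc (suc t)))

    insert-rows : (∀ t → p (suc (suc t)) ≤ p (suc t)) → (∀ t → q (suc (suc t)) ≤ q (suc t)) → (∀ t → q (suc t) ≤ p (suc t)) →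
      ∀ k N cs → Frontier k cs → length cs ≡ N → length (foldr insertCell cs (concatMap rowCellsAt (upTo k))) ≡ N + sumBelow componentStartAt k
    insert-rows pd qd qp zero N cs f1 len = trans len (sym (+-identityʳ N))
    insert-rows pd qd qp (suc k) N cs f1 len = begin≡
      length (foldr insertCell cs (concatMap rowCellsAt (upTo (suc k))))
        ≡⟨ cong (λ z → length (foldr insertCell cs z)) eqC ⟩
      length (foldr insertCell cs (concatMap rowCellsAt (upTo k) ++ rowCellsAt k))
        ≡⟨ cong length (LP.foldr-++ insertCell cs (concatMap rowCellsAt (upTo k)) (rowCellsAt k)) ⟩
      length (foldr insertCell cs1 (concatMap rowCellsAt (upTo k)))
        ≡⟨ insert-rows pd qd qp k (N + componentStartAt k) cs1 (proj₁ re) (proj₂ re) ⟩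
      N + componentStartAt k + sumBelow componentStartAt k ≡⟨ +-assoc N (componentStartAt k) (sumBelow componentStartAt k) ⟩
      N + (componentStartAt k + sumBelow componentStartAt k) ≡⟨ cong (N +_) (trans (+-comm (componentStartAt k) (sumBelow componentStartAt k)) (sym (sumBelow-snoc componentStartAt k))) ⟩
      N + sumBelow componentStartAt (suc k) ∎≡
      where
      import Data.List.Properties as LP
      open ≡-Reasoning renaming (begin_ to begin≡_; _∎ to _∎≡)
      cs1 = foldr insertCell cs (rowCellsAt k)
      eqC : concatMap rowCellsAt (upTo (suc k)) ≡ concatMap rowCellsAt (upTo k) ++ rowCellsAt k
      eqC = trans (cong (concatMap rowCellsAt) (sym (LP.upTo-∷ʳ k))) (trans (LP.concatMap-++ rowCellsAt (upTo k) (k ∷ [])) (cong (concatMap rowCellsAt (upTo k) ++_) (LP.++-identityʳ (rowCellsAt k))))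
      st : RowState (suc k) (q (suc k)) N cs1
      st = insert-row (suc k) (p (suc k)) N cs (qd k) (pd k) (qp k) (fresh refl f1 len)
      re = row-end k N cs1 st

  open PartitionLists using (Decreasing; part-dec; part-beyond)

  compsOf≡sumBelow-componentStart : ∀ λ′ μ W → Decreasing λ′ → Decreasing μ → (∀ j → part μ j ≤ part λ′ j) → length λ′ ≤ W →
    compsOf λ′ μ ≡ sumBelow (λ t → componentStart (part λ′ (suc t)) (part μ (suc t)) (part λ′ (suc (suc t)))) W
  compsOf≡sumBelow-componentStart λ′ μ W dλ dm qp le =
    trans (ByRows.insert-rows (part λ′) (part μ) (part-dec λ′ dλ) (part-dec μ dm) (λ t → qp (suc t)) (length λ′) 0 []
            (ByRows.emptyFrontier (≤-trans (≤-reflexive (part-beyond λ′ (length λ′) ≤-refl)) z≤n) []) refl)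
      (sumBelow-extend _ (length λ′) W le (λ t lt → cong (λ z → count ((part μ (suc t) <ᵇ z) ∧ (part λ′ (suc (suc t)) ≤ᵇ part μ (suc t)))) (part-beyond λ′ t lt)))


module SkewWeight where

  open import Defs
  open PartitionLists
  open ShapeCounts
  open NatSums
  open ComponentCount using (compsOf≡sumBelow-componentStart)
  open RowMonomial using (module Monomials)
  open import Data.Nat using (suc; _≤_; _∸_)
  open import Data.Nat.Properties using (≤-trans)
  open import Data.List using (length)
  open import Data.Product using (_,_)
  open import Relation.Binary.PropositionalEquality using (_≡_; trans; cong₂)
  open import Algebra.Bundles using (CommutativeRing)
  open RowWeight using (module Weights)

  size-difference : ∀ λ′ μ W → length λ′ ≤ W → length μ ≤ W → (∀ j → part μ j ≤ part λ′ j) →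
    size λ′ ∸ size μ ≡ sumBelow (λ t → part λ′ (suc t) ∸ part μ (suc t)) W
  size-difference λ′ μ W l1 l2 qp = trans (cong₂ _∸_ (sum≡sumBelow-parts λ′ W l1) (sum≡sumBelow-parts μ W l2)) (sumBelow-∸ _ _ W (λ t → qp (suc t)))

  rowWeight≈gSkew : ∀ {c ℓ} (R : CommutativeRing c ℓ) (α β x : CommutativeRing.Carrier R) W λ′ μ → IsPartition λ′ → IsPartition μ → length μ ≤ length λ′ → (∀ j → part μ j ≤ part λ′ j) → length λ′ ≤ W →
       CommutativeRing._≈_ R (Weights.rowWeight R α β x (parts W λ′) (parts W μ)) (gSkew R α β λ′ μ x)
  rowWeight≈gSkew R α β x W λ′ μ (dλ , _) (dm , _) lμ qp le =
    Monomials.rowWeight≈gSkew-from-counts R α β x λ′ μ W (part-beyond λ′ W le) (part-beyond μ W (≤-trans lμ le)) qp (part-dec λ′ dλ) (part-dec μ dm)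
      (rowsOf≡sumBelow-rowOccupied λ′ μ W le) (compsOf≡sumBelow-componentStart λ′ μ W dλ dm qp le) (colsOf≡sumBelow-newColumns λ′ μ W dλ dm qp le) (size-difference λ′ μ W le (≤-trans lμ le) qp)


module Transfer where

  open import Defs
  open FiniteSums
  open NatBool
  open PartitionLists
  open SuffixSums
  open RowWeight
  open SkewWeight using (rowWeight≈gSkew)
  open import Level using (Level)
  open import Data.Bool using (Bool; true; false)
  open import Data.Bool.Properties using (¬-not)
  open import Data.Nat using (ℕ; zero; suc; _+_; _∸_; _≤_; _<_; _≡ᵇ_)
  open import Data.Nat.Properties using (≤-trans; m+[n∸m]≡n; ≤-refl; m∸n≤m; <-irrefl)
  open import Data.Nat.ListAction using (sum)
  open import Data.List using (List; []; _∷_; map; length; _++_; applyUpTo; replicate; reverse; [_])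
  open import Data.List.Properties using (length-replicate; unfold-reverse)
  open import Data.List.Relation.Unary.All as All using (All; []; _∷_)
  open import Data.List.Relation.Binary.Pointwise using (Pointwise; Pointwise-length)
  open import Data.List.Membership.Propositional using (_∈_)
  open import Data.List.Membership.Propositional.Properties using (∈-map⁺; ∈-applyUpTo⁺)
  open import Data.Product using (_,_; proj₁; proj₂)
  open import Data.Empty using (⊥)
  open import Relation.Binary.PropositionalEquality as P using (_≡_)
  open import Algebra.Bundles using (CommutativeRing)
  open import Data.Vec as V using (Vec; toList)

  topLabels : ℕ → List ℕ → List ℕ
  topLabels W μ = map (mc μ) (applyUpTo suc W)

  topLabels≡differences : ∀ μ W → length μ ≤ W → topLabels W μ ≡ differences (parts W μ)
  topLabels≡differences μ W le = P.sym (differences-parts (part μ) suc W (λ _ → P.refl) (part-beyond μ W le))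

  topLabels-pointwise≤ : ∀ λ′ W M → sum λ′ ≤ M → Pointwise _≤_ (topLabels W λ′) (replicate W M)
  topLabels-pointwise≤ λ′ W M s≤M =
    map-pointwise≤ (mc λ′) suc W M (λ t → ≤-trans (m∸n≤m (part λ′ t) (part λ′ (suc t))) (≤-trans (part≤sum λ′ t) s≤M))

  eqᵇ-zeros-topLabels : ∀ λ′ W → IsPartition λ′ → length λ′ ≤ W → eqᵇ (replicate W 0) (topLabels W λ′) ≡ (length λ′ ≡ᵇ 0)
  eqᵇ-zeros-topLabels [] W _ _ = eqᵇ-zeros suc W
    where
    eqᵇ-zeros : ∀ (f : ℕ → ℕ) k → eqᵇ (replicate k 0) (map (λ _ → 0) (applyUpTo f k)) ≡ true
    eqᵇ-zeros f zero = P.refl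
    eqᵇ-zeros f (suc k) = eqᵇ-zeros (λ t → f (suc t)) k
  eqᵇ-zeros-topLabels (a ∷ r) W (_ , pos) le = ¬-not last-label-nonzero
    where
    eqᵇ-zeros⇒zeros : ∀ k ys → eqᵇ (replicate k 0) ys ≡ true → All (_≡ 0) ys
    eqᵇ-zeros⇒zeros zero [] e = []
    eqᵇ-zeros⇒zeros (suc k) (y ∷ ys) e = P.sym (≡ᵇ→≡ 0 y (proj₁ (∧-true⁻ e))) ∷ eqᵇ-zeros⇒zeros k ys (proj₂ (∧-true⁻ {0 ≡ᵇ y} e))

    last-part-positive : ∀ a r → All (0 <_) (a ∷ r) → 0 < part (a ∷ r) (length (a ∷ r))
    last-part-positive a [] (p ∷ _) = p
    last-part-positive a (b ∷ r) (_ ∷ ps) = last-part-positive b r ps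

    ℓ = length (a ∷ r)

    last-label-nonzero : eqᵇ (replicate W 0) (topLabels W (a ∷ r)) ≡ true → ⊥
    last-label-nonzero e = <-irrefl P.refl (P.subst (0 <_) mc≡0 (last-part-positive a r pos))
      where
      mc≡0 : part (a ∷ r) ℓ ≡ 0
      mc≡0 = P.trans (P.sym (P.cong (part (a ∷ r) ℓ ∸_) (part-beyond (a ∷ r) ℓ ≤-refl)))
                     (All.lookup (eqᵇ-zeros⇒zeros W _ e) (∈-map⁺ (mc (a ∷ r)) (∈-applyUpTo⁺ suc le)))

  module Model {c ℓ : Level} (R : CommutativeRing c ℓ) (α β : CommutativeRing.Carrier R) where
    open CommutativeRing R hiding (zero) renaming (_+_ to _⊕_; _*_ to _⊛_)
    open Sums R
    open Reindexing R using (∑-suffixSums)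
    open Weights R α β using (rowWeight; rowZ-differences)
    open import Relation.Binary.Reasoning.Setoid setoid
    open import Algebra.Properties.CommutativeSemigroup *-commutativeSemigroup using (x∙yz≈y∙xz)

    ∑-rowZ-differences : ∀ x M L → All (_≤ M) L → Decreasing L → (F : List ℕ → Carrier) →
      ∑ (labelVecs R (length L) M) (λ v → F v ⊛ rowZ R α β M x v (differences L))
        ≈ ∑ (boxChoices L) (λ u → 𝟙 (decreasingᵇ u) ⊛ (F (differences u) ⊛ rowWeight x L u))
    ∑-rowZ-differences x M L L≤M dL F = begin
      ∑ (labelVecs R (length L) M) (λ v → F v ⊛ rowZ R α β M x v (differences L))
        ≈⟨ ∑-cong-∈ (labelVecs R (length L) M) (λ v v∈ → trans (*-cong refl (rowZ-differences x M L v (length-v v∈) L≤M dL)) (reorder v)) ⟩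
      ∑ (labelVecs R (length L) M) (λ v → 𝟙 (pointwise≤ᵇ (suffixSums v) L) ⊛ K (suffixSums v))
        ≈⟨ ∑-suffixSums M L L≤M K ⟩
      ∑ (boxChoices L) (λ u → 𝟙 (decreasingᵇ u) ⊛ K u) ∎
      where
      K : List ℕ → Carrier
      K U = F (differences U) ⊛ rowWeight x L U
      length-v : ∀ {v} → v ∈ labelVecs R (length L) M → length v ≡ length L
      length-v v∈ = P.trans (Pointwise-length (boxChoices-pointwise (replicate (length L) M) v∈)) (length-replicate (length L))
      reorder : ∀ v → F v ⊛ (𝟙 (pointwise≤ᵇ (suffixSums v) L) ⊛ rowWeight x L (suffixSums v))
                      ≈ 𝟙 (pointwise≤ᵇ (suffixSums v) L) ⊛ K (suffixSums v)
      reorder v = trans (x∙yz≈y∙xz _ _ _) (*-cong refl (*-cong (reflexive (P.cong F (P.sym (differences-suffixSums v)))) refl))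

    padded-term : ∀ x W λ′ → IsPartition λ′ → length λ′ ≤ W → (F : List ℕ → Carrier) → ∀ u → Pointwise _≤_ u λ′ →
      𝟙 (decreasingᵇ (u ++ replicate (W ∸ length λ′) 0))
        ⊛ (F (differences (u ++ replicate (W ∸ length λ′) 0)) ⊛ rowWeight x (parts W λ′) (u ++ replicate (W ∸ length λ′) 0))
        ≈ 𝟙 (decreasingᵇ u) ⊛ (F (topLabels W (dropZeros u)) ⊛ gSkew R α β λ′ (dropZeros u) x)
    padded-term x W λ′ isλ ℓ≤W F u u≤λ with decreasingᵇ u in ed
    ... | false = trans (*-cong (reflexive (P.cong 𝟙 (P.trans (decreasingᵇ-padded u k) ed))) refl) (trans (zeroˡ _) (sym (zeroˡ _)))
      where k = W ∸ length λ′
    ... | true = *-cong (reflexive (P.cong 𝟙 (P.trans (decreasingᵇ-padded u k) ed))) (*-cong (reflexive (P.cong F labels)) weights)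
      where
      k = W ∸ length λ′
      μ = dropZeros u
      du : Decreasing u
      du = decreasingᵇ⇒Decreasing u ed
      ℓu≡ℓλ : length u ≡ length λ′
      ℓu≡ℓλ = Pointwise-length u≤λ
      ℓμ≤ℓλ : length μ ≤ length λ′
      ℓμ≤ℓλ = P.subst (length μ ≤_) ℓu≡ℓλ (dropZeros-length u)
      padded : u ++ replicate k 0 ≡ parts W μ
      padded = P.trans (padded-dropZeros u k du) (P.cong (λ t → parts t μ) (P.trans (P.cong (_+ k) ℓu≡ℓλ) (m+[n∸m]≡n ℓ≤W)))
      labels : differences (u ++ replicate k 0) ≡ topLabels W μ
      labels = P.trans (P.cong differences padded) (P.sym (topLabels≡differences μ W (≤-trans ℓμ≤ℓλ ℓ≤W)))
      μ≤λ : ∀ j → part μ j ≤ part λ′ j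
      μ≤λ j = P.subst (_≤ part λ′ j) (P.sym (dropZeros-part u du j)) (pointwise-part≤ u≤λ j)
      weights : rowWeight x (parts W λ′) (u ++ replicate k 0) ≈ gSkew R α β λ′ μ x
      weights = trans (reflexive (P.cong (rowWeight x (parts W λ′)) padded))
                      (rowWeight≈gSkew R α β x W λ′ μ isλ (dropZeros-decreasing u du , dropZeros-positive u) ℓμ≤ℓλ μ≤λ ℓ≤W)

    -- One row of the model is the branching rule g_λ(…, x) = Σ_μ g_μ(…) g_{λ/μ}(x): its bottom
    -- labels v are the top labels m^c(μ) of the partition μ with parts the suffix sums of v.
    ∑-rowZ : ∀ x W M λ′ → IsPartition λ′ → length λ′ ≤ W → sum λ′ ≤ M → (F : List ℕ → Carrier) →
      ∑ (labelVecs R W M) (λ v → F v ⊛ rowZ R α β M x v (topLabels W λ′))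
        ≈ ∑ (subPartitions λ′) (λ μ → F (topLabels W μ) ⊛ gSkew R α β λ′ μ x)
    ∑-rowZ x W M λ′ isλ@(dλ , _) ℓ≤W s≤M F = begin
      ∑ (labelVecs R W M) (λ v → F v ⊛ rowZ R α β M x v (topLabels W λ′))
        ≡⟨ P.cong₂ (λ w t → ∑ (labelVecs R w M) (λ v → F v ⊛ rowZ R α β M x v t)) (P.sym (length-parts W λ′)) (topLabels≡differences λ′ W ℓ≤W) ⟩
      ∑ (labelVecs R (length L) M) (λ v → F v ⊛ rowZ R α β M x v (differences L))
        ≈⟨ ∑-rowZ-differences x M L L≤M (decreasing-parts (part λ′) suc W (part-dec λ′ dλ)) F ⟩
      ∑ (boxChoices L) (λ u → 𝟙 (decreasingᵇ u) ⊛ K u)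
        ≡⟨ P.cong (λ t → ∑ (boxChoices t) (λ u → 𝟙 (decreasingᵇ u) ⊛ K u)) L≡padded ⟩
      ∑ (boxChoices (λ′ ++ replicate k 0)) (λ u → 𝟙 (decreasingᵇ u) ⊛ K u)
        ≈⟨ ∑-boxChoices-padded λ′ k _ ⟩
      ∑ (boxChoices λ′) (λ u → 𝟙 (decreasingᵇ (u ++ replicate k 0)) ⊛ K (u ++ replicate k 0))
        ≈⟨ ∑-cong-∈ (boxChoices λ′) (λ u u∈ → padded-term x W λ′ isλ ℓ≤W F u (boxChoices-pointwise λ′ u∈)) ⟩
      ∑ (boxChoices λ′) (λ u → 𝟙 (decreasingᵇ u) ⊛ G (dropZeros u))
        ≈⟨ sym (∑-filt decreasingᵇ (boxChoices λ′) _) ⟩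
      ∑ (filt decreasingᵇ (boxChoices λ′)) (λ u → G (dropZeros u))
        ≡⟨ P.sym (∑-map dropZeros (filt decreasingᵇ (boxChoices λ′)) G) ⟩
      ∑ (subPartitions λ′) G ∎
      where
      k = W ∸ length λ′
      L = parts W λ′
      K : List ℕ → Carrier
      K u = F (differences u) ⊛ rowWeight x L u
      G : List ℕ → Carrier
      G μ = F (topLabels W μ) ⊛ gSkew R α β λ′ μ x
      L≤M : All (_≤ M) L
      L≤M = parts-bounded (part λ′) suc W M (λ t → ≤-trans (part≤sum λ′ t) s≤M)
      L≡padded : L ≡ λ′ ++ replicate k 0
      L≡padded = P.trans (P.cong (λ t → parts t λ′) (P.sym (m+[n∸m]≡n ℓ≤W))) (parts-padded λ′ k)

    module _ (W M : ℕ) where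
      private
        LV = labelVecs R W M

      -- The rows x_m, …, x_1 stacked with x_1 at the bottom.
      stackZ : List Carrier → List ℕ → List ℕ → Carrier
      stackZ [] bot top = 𝟙 (eqᵇ bot top)
      stackZ (y ∷ ys) bot top = ∑ LV (λ mid → stackZ ys bot mid ⊛ rowZ R α β M y mid top)

      Labels : List ℕ → Set
      Labels b = Pointwise _≤_ b (replicate W M)

      stackZ-snoc : ∀ r x bot top → Labels bot → Labels top →
        stackZ (r ++ [ x ]) bot top ≈ ∑ LV (λ m → rowZ R α β M x bot m ⊛ stackZ r m top)
      stackZ-snoc [] x bot top b≤ t≤ = begin
        ∑ LV (λ m → 𝟙 (eqᵇ bot m) ⊛ rowZ R α β M x m top) ≈⟨ ∑-𝟙-eqᵇ (replicate W M) bot b≤ _ ⟩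
        rowZ R α β M x bot top                           ≈⟨ sym (∑-𝟙-eqᵇ (replicate W M) top t≤ _) ⟩
        ∑ LV (λ m → 𝟙 (eqᵇ top m) ⊛ rowZ R α β M x bot m)
          ≈⟨ ∑-cong LV (λ m → trans (*-comm _ _) (*-cong refl (reflexive (P.cong 𝟙 (eqᵇ-sym top m))))) ⟩
        ∑ LV (λ m → rowZ R α β M x bot m ⊛ 𝟙 (eqᵇ m top)) ∎
      stackZ-snoc (z ∷ r) x bot top b≤ t≤ = begin
        ∑ LV (λ m → stackZ (r ++ [ x ]) bot m ⊛ rowZ R α β M z m top)
          ≈⟨ ∑-cong-∈ LV (λ m m∈ → *-cong (stackZ-snoc r x bot m b≤ (boxChoices-pointwise _ m∈)) refl) ⟩
        ∑ LV (λ m → ∑ LV (λ m′ → rowZ R α β M x bot m′ ⊛ stackZ r m′ m) ⊛ rowZ R α β M z m top)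
          ≈⟨ ∑-cong LV (λ m → trans (∑-*ʳ _ LV _) (∑-cong LV (λ m′ → *-assoc _ _ _))) ⟩
        ∑ LV (λ m → ∑ LV (λ m′ → rowZ R α β M x bot m′ ⊛ (stackZ r m′ m ⊛ rowZ R α β M z m top)))
          ≈⟨ ∑-swap LV LV _ ⟩
        ∑ LV (λ m′ → ∑ LV (λ m → rowZ R α β M x bot m′ ⊛ (stackZ r m′ m ⊛ rowZ R α β M z m top)))
          ≈⟨ ∑-cong LV (λ m′ → sym (∑-*ˡ _ LV _)) ⟩
        ∑ LV (λ m′ → rowZ R α β M x bot m′ ⊛ stackZ (z ∷ r) m′ top) ∎

      latticeZ≈stackZ : ∀ n (xs : Vec Carrier (suc n)) bot top → Labels bot → Labels top →
        latticeZ R α β W M xs bot top ≈ stackZ (reverse (toList xs)) bot top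
      latticeZ≈stackZ zero (x V.∷ V.[]) bot top b≤ t≤ = sym (∑-𝟙-eqᵇ (replicate W M) bot b≤ _)
      latticeZ≈stackZ (suc n) (x V.∷ y V.∷ xs) bot top b≤ t≤ = begin
        ∑ LV (λ m → rowZ R α β M x bot m ⊛ latticeZ R α β W M (y V.∷ xs) m top)
          ≈⟨ ∑-cong-∈ LV (λ m m∈ → *-cong refl (latticeZ≈stackZ n (y V.∷ xs) m top (boxChoices-pointwise _ m∈) t≤)) ⟩
        ∑ LV (λ m → rowZ R α β M x bot m ⊛ stackZ (reverse (toList (y V.∷ xs))) m top)
          ≈⟨ sym (stackZ-snoc (reverse (toList (y V.∷ xs))) x bot top b≤ t≤) ⟩
        stackZ (reverse (toList (y V.∷ xs)) ++ [ x ]) bot top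
          ≡⟨ P.cong (λ t → stackZ t bot top) (P.sym (unfold-reverse x (toList (y V.∷ xs)))) ⟩
        stackZ (reverse (x ∷ toList (y V.∷ xs))) bot top ∎

      gRev≈stackZ : ∀ ys λ′ → IsPartition λ′ → length λ′ ≤ W → sum λ′ ≤ M →
        gRev R α β λ′ ys ≈ stackZ ys (replicate W 0) (topLabels W λ′)
      gRev≈stackZ [] λ′ isλ ℓ≤W s≤M = reflexive (P.cong 𝟙 (P.sym (eqᵇ-zeros-topLabels λ′ W isλ ℓ≤W)))
      gRev≈stackZ (y ∷ ys) λ′ isλ ℓ≤W s≤M = begin
        ∑ (subPartitions λ′) (λ μ → gRev R α β μ ys ⊛ gSkew R α β λ′ μ y)
          ≈⟨ ∑-cong-∈ (subPartitions λ′) (λ μ μ∈ → let (isμ , ℓμ≤ℓλ , sμ≤sλ) = subPartitions-facts λ′ μ μ∈ in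
               *-cong (gRev≈stackZ ys μ isμ (≤-trans ℓμ≤ℓλ ℓ≤W) (≤-trans sμ≤sλ s≤M)) refl) ⟩
        ∑ (subPartitions λ′) (λ μ → stackZ ys (replicate W 0) (topLabels W μ) ⊛ gSkew R α β λ′ μ y)
          ≈⟨ sym (∑-rowZ y W M λ′ isλ ℓ≤W s≤M (λ v → stackZ ys (replicate W 0) v)) ⟩
        ∑ LV (λ v → stackZ ys (replicate W 0) v ⊛ rowZ R α β M y v (topLabels W λ′)) ∎


open import Data.Vec using (toList)
open import Data.List using (reverse; replicate)
open PartitionLists using (zeros-pointwise≤)
open Transfer using (topLabels; topLabels-pointwise≤; module Model)

theorem3p2 : ∀ {c ℓ} (R : CommutativeRing c ℓ) (α β : CommutativeRing.Carrier R)
    (n : ℕ) (xs : Vec (CommutativeRing.Carrier R) (suc n)) (λ′ : List ℕ) → IsPartition λ′ →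
    (W M : ℕ) → length λ′ ≤ W → sum λ′ ≤ M →
    CommutativeRing._≈_ R (gDual R α β λ′ xs) (modelZ R α β λ′ W M xs)
theorem3p2 R α β n xs λ′ isλ W M ℓ≤W s≤M = begin
  gDual R α β λ′ xs
    ≈⟨ gRev≈stackZ W M (reverse (toList xs)) λ′ isλ ℓ≤W s≤M ⟩
  stackZ W M (reverse (toList xs)) (replicate W 0) (topLabels W λ′)
    ≈⟨ sym (latticeZ≈stackZ W M n xs _ _ (zeros-pointwise≤ W M) (topLabels-pointwise≤ λ′ W M s≤M)) ⟩
  modelZ R α β λ′ W M xs ∎
  where
  open CommutativeRing R using (setoid; sym)
  open import Relation.Binary.Reasoning.Setoid setoid
  open Model R α β
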